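{- Let $\mu_0$ be any partition all of whose parts are at least $2$ (possibly empty). Define, for $n\ge|\mu_0|$, $$\psi^{(2)}_n\big(\mu_0 1^{n-|\mu_0|}\big)=\sum_{j=0}^{\lfloor n/2\rfloor}\chi^{(n-j,j)}\big(\mu_0 1^{n-|\mu_0|}\big)^2 .$$ Then there exists a rational function $R_{\mu_0}(n)\in\mathbb{Q}(n)$ such that $\psi^{(2)}_n(\mu_0 1^{n-|\mu_0|})=R_{\mu_0}(n)\binom{2n}{n}$ for all integers $n\ge|\mu_0|$.
   Context: For partitions $\lambda,\mu$ of $n$, $\chi^{\lambda}(\mu)$ is the value of the irreducible character of $S_n$ indexed by $\lambda$ on permutations of cycle type $\mu$; $(n-j,j)$ denotes the two-row shape (for $j=0$ the one-row shape $(n)$). $|\mu_0|$ is the sum of parts of $\mu_0$, and $\mu_0 1^{n-|\mu_0|}$ is the partition of $n$ obtained from $\mu_0$ by appending $n-|\mu_0|$ ones. -}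

module Defs where

open import Data.Nat as ℕ using (ℕ; zero; suc; _∸_; _≤_; _≥_; _≡ᵇ_)
open import Data.Nat.Combinatorics using (_C_)
open import Data.Integer as ℤ using (ℤ; +_)
open import Data.Rational as ℚ using (ℚ; _/_)
open import Data.List using (List; []; _∷_; length; map; replicate; _++_; upTo; foldr)
open import Data.List.Relation.Unary.All using (All)
open import Data.List.Relation.Unary.Linked using (Linked)
open import Data.Product using (_×_)
open import Data.Bool using (Bool; true; false; if_then_else_)

IsPartition : List ℕ → Set
IsPartition xs = Linked (λ a b → b ≤ a) xs × All (λ a → 1 ≤ a) xs
size : List ℕ → ℕ
size = foldr ℕ._+_ 0

-- Irreducible characters of S_n via the Murnaghan–Nakayama rule,
-- implemented with beta-sets: λ = (λ₁ ≥ … ≥ λ_ℓ) has beta-set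
-- {λ_i + ℓ - i}.  Removing a rim hook of length r corresponds to
-- replacing some b by b - r ≥ 0 with b - r not in the beta-set; the
-- sign is (-1)^(number of beta-set elements strictly between b-r and b).

betaSet : List ℕ → List ℕ
betaSet λs = go λs (length λs)
  where
  go : List ℕ → ℕ → List ℕ
  go []       _ = []
  go (x ∷ xs) ℓ = (x ℕ.+ (ℓ ∸ 1)) ∷ go xs (ℓ ∸ 1)

member : ℕ → List ℕ → Bool
member x []       = false
member x (y ∷ ys) = if x ≡ᵇ y then true else member x ys

countBetween : ℕ → ℕ → List ℕ → ℕ
countBetween a b []       = 0
countBetween a b (c ∷ cs) =
  (if (a ℕ.<ᵇ c) Data.Bool.∧ (c ℕ.<ᵇ b) then 1 else 0) ℕ.+ countBetween a b cs

signPow : ℕ → ℤ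
signPow zero          = ℤ.+ 1
signPow (suc zero)    = ℤ.- (ℤ.+ 1)
signPow (suc (suc k)) = signPow k

replaceAt : ℕ → ℕ → List ℕ → List ℕ
replaceAt b b' []       = []
replaceAt b b' (c ∷ cs) = if c ≡ᵇ b then b' ∷ cs else c ∷ replaceAt b b' cs

mnβ : List ℕ → List ℕ → ℤ
mnβ β []       = ℤ.+ 1
mnβ β (r ∷ μ)  = go β
  where
  go : List ℕ → ℤ
  go []       = ℤ.+ 0
  go (b ∷ bs) =
    (if (r ℕ.≤ᵇ b) Data.Bool.∧ Data.Bool.not (member (b ∸ r) β)
       then signPow (countBetween (b ∸ r) b β) ℤ.* mnβ (replaceAt b (b ∸ r) β) μ
       else ℤ.+ 0)
    ℤ.+ go bs

-- χ^λ(μ), meaningful when λ and μ are partitions of the same n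
χ : List ℕ → List ℕ → ℤ
χ λs μ = mnβ (betaSet λs) μ

twoRow : ℕ → ℕ → List ℕ
twoRow n zero    = n ∷ []
twoRow n (suc j) = (n ∸ suc j) ∷ suc j ∷ []

padOnes : List ℕ → ℕ → List ℕ
padOnes μ₀ n = μ₀ ++ replicate (n ∸ size μ₀) 1

ψ2 : ℕ → List ℕ → ℤ
ψ2 n μ = foldr ℤ._+_ (ℤ.+ 0) (map (λ j → χ (twoRow n j) μ ℤ.* χ (twoRow n j) μ) (upTo (suc (n ℕ./ 2))))

-- Polynomials over ℚ as coefficient lists (constant term first),
-- evaluated at a natural number; a rational function is P/Q.

evalPoly : List ℚ → ℕ → ℚ
evalPoly cs n = foldr (λ c acc → c ℚ.+ ((+ n) / 1) ℚ.* acc) ℚ.0ℚ cs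

ℤtoℚ : ℤ → ℚ
ℤtoℚ z = z / 1

ℕtoℚ : ℕ → ℚ
ℕtoℚ m = (+ m) / 1

{-# OPTIONS --safe #-}

-- By the Murnaghan–Nakayama rule on a two-bead abacus, χ^(n-j,j)(μ) for 2j ≤ n is the
-- coefficient of xʲ in U(x) = (1 - x) ∏_{r ∈ μ} (1 + xʳ).  Since U(1/x) = -x^{-(n+1)} U(x),
-- twice ψ is the full sum of squares of the coefficients of U, i.e. the constant term of
-- U(x) U(1/x) = (2 - x - x⁻¹) (x + 2 + x⁻¹)ᴺ ∏_{r ∈ μ₀} (2 + xʳ + x⁻ʳ),  N = n - |μ₀|.
-- Expanding the factors that do not depend on n, this constant term is a fixed integer
-- combination of the numbers C(2N, N + s) with |s| ≤ K = |μ₀| + 1, and each of them is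
-- C(2n, n) times a rational function of n:
--   C(2N, N + s) (n + 1) (2n + 2)(2n + 1)⋯(2n + 3 - 2K) = C(2n, n) 2(2n + 1) (n + 1)_{K-s} (n + 1)_{K+s},
-- where (m)_a is the falling factorial.

module Submission where

open import Defs
open import Data.Bool.Base using (true; false; if_then_else_; _∧_; not)
open import Data.Nat using (ℕ; zero; suc; _+_; _*_; _∸_; _≤_; _<_; _!; z≤n; s≤s; s≤s⁻¹; _<ᵇ_; _≤ᵇ_; _≡ᵇ_)
open import Data.Nat.Combinatorics using (_C_; nCk≡n!/k![n-k]!; k![n∸k]!∣n!; k>n⇒nCk≡0; nCk+nC[k+1]≡[n+1]C[k+1])
open import Data.Nat.Combinatorics.Base using (_P′_)
open import Data.Nat.DivMod using (_/_; _%_; m≡m%n+[m/n]*n; m%n<n; m/n*n≡m)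
open import Data.Nat.ListAction.Properties using (sum-++)
import Data.Nat.Properties as ℕ
open import Data.Nat.Properties using (_!*_!≢0)
import Data.Nat.Tactic.RingSolver as ℕ-Solver
open import Data.Integer.Base as ℤ using (ℤ; +_; -[1+_]; 0ℤ; 1ℤ; -1ℤ)
import Data.Integer.Properties as ℤ
open import Data.Integer.Tactic.RingSolver using (solve-∀)
open import Data.List using (List; []; _∷_; _++_; replicate; map; foldr; applyUpTo)
open import Data.List.Relation.Unary.All using (All; []; _∷_)
open import Data.List.Relation.Unary.All.Properties using (++⁺)
open import Data.Product using (Σ; _×_; _,_; proj₂)
open import Data.Rational using (ℚ; 0ℚ)
open import Data.Rational.Base as ℚ using (toℚᵘ)
import Data.Rational.Properties as ℚ
open import Data.Rational.Unnormalised.Base as ℚᵘ using (mkℚᵘ; *≡*)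
import Data.Rational.Unnormalised.Properties as ℚᵘ
open import Data.Sum using (_⊎_; inj₁; inj₂)
open import Function using (_∘_)
open import Relation.Binary.Definitions using (tri<; tri≈; tri>)
open import Relation.Binary.PropositionalEquality
open import Relation.Nullary using (¬_; yes; no; contradiction)
open import Relation.Nullary.Reflects using (ofʸ; ofⁿ; det; fromEquivalence)

∑< : ℕ → (ℕ → ℤ) → ℤ
∑< zero    f = 0ℤ
∑< (suc n) f = f 0 ℤ.+ ∑< n (λ i → f (suc i))

syntax ∑< n (λ i → e) = ∑[ i < n ] e

∑-cong : ∀ n {f g : ℕ → ℤ} → (∀ i → i < n → f i ≡ g i) → ∑< n f ≡ ∑< n g
∑-cong zero    eq = refl
∑-cong (suc n) eq = cong₂ ℤ._+_ (eq 0 (s≤s z≤n)) (∑-cong n (λ i i<n → eq (suc i) (s≤s i<n)))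

∑-zero : ∀ n {f : ℕ → ℤ} → (∀ i → i < n → f i ≡ 0ℤ) → ∑< n f ≡ 0ℤ
∑-zero zero    eq = refl
∑-zero (suc n) eq = cong₂ ℤ._+_ (eq 0 (s≤s z≤n)) (∑-zero n (λ i i<n → eq (suc i) (s≤s i<n)))

∑-+ : ∀ n (f g : ℕ → ℤ) → ∑[ i < n ] (f i ℤ.+ g i) ≡ ∑< n f ℤ.+ ∑< n g
∑-+ zero    f g = refl
∑-+ (suc n) f g = begin
  (f 0 ℤ.+ g 0) ℤ.+ ∑[ i < n ] (f (suc i) ℤ.+ g (suc i))
    ≡⟨ cong (ℤ._+_ (f 0 ℤ.+ g 0)) (∑-+ n (λ i → f (suc i)) (λ i → g (suc i))) ⟩
  (f 0 ℤ.+ g 0) ℤ.+ (∑[ i < n ] f (suc i) ℤ.+ ∑[ i < n ] g (suc i))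
    ≡⟨ interchange (f 0) (g 0) _ _ ⟩
  (f 0 ℤ.+ ∑[ i < n ] f (suc i)) ℤ.+ (g 0 ℤ.+ ∑[ i < n ] g (suc i)) ∎
  where
  open ≡-Reasoning
  interchange : ∀ a b c d → (a ℤ.+ b) ℤ.+ (c ℤ.+ d) ≡ (a ℤ.+ c) ℤ.+ (b ℤ.+ d)
  interchange = solve-∀

∑-split : ∀ m n (f : ℕ → ℤ) → ∑< (m + n) f ≡ ∑< m f ℤ.+ ∑[ i < n ] f (m + i)
∑-split zero    n f = sym (ℤ.+-identityˡ _)
∑-split (suc m) n f = trans (cong (ℤ._+_ (f 0)) (∑-split m n (λ i → f (suc i))))
                            (sym (ℤ.+-assoc (f 0) _ _))

∑-last : ∀ n (f : ℕ → ℤ) → ∑< (suc n) f ≡ ∑< n f ℤ.+ f n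
∑-last n f = begin
  ∑< (suc n) f              ≡⟨ cong (λ m → ∑< m f) (ℕ.+-comm 1 n) ⟩
  ∑< (n + 1) f              ≡⟨ ∑-split n 1 f ⟩
  ∑< n f ℤ.+ (f (n + 0) ℤ.+ 0ℤ) ≡⟨ cong (ℤ._+_ (∑< n f)) (trans (ℤ.+-identityʳ _) (cong f (ℕ.+-identityʳ n))) ⟩
  ∑< n f ℤ.+ f n            ∎
  where open ≡-Reasoning

∑-reverse : ∀ n {f g : ℕ → ℤ} → (∀ i j → suc (i + j) ≡ n → f i ≡ g j) → ∑< n f ≡ ∑< n g
∑-reverse zero    eq = refl
∑-reverse (suc n) {f} {g} eq = begin
  f 0 ℤ.+ ∑[ i < n ] f (suc i) ≡⟨ cong₂ ℤ._+_ (eq 0 n refl) (∑-reverse n (λ i j e → eq (suc i) j (cong suc e))) ⟩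
  g n ℤ.+ ∑< n g               ≡⟨ ℤ.+-comm (g n) _ ⟩
  ∑< n g ℤ.+ g n               ≡⟨ ∑-last n g ⟨
  ∑< (suc n) g                 ∎
  where open ≡-Reasoning


foldr-map-applyUpTo : ∀ {A : Set} (g : A → ℤ) (f : ℕ → A) m →
  foldr ℤ._+_ 0ℤ (map g (applyUpTo f m)) ≡ ∑[ i < m ] g (f i)
foldr-map-applyUpTo g f zero    = refl
foldr-map-applyUpTo g f (suc m) = cong (ℤ._+_ (g (f 0))) (foldr-map-applyUpTo g (λ i → f (suc i)) m)

private
  shifted-pair : ∀ {h i j} k → i + j ≡ h → k + i + j ≡ k + h
  shifted-pair {h} {i} {j} k i+j≡h = trans (ℕ.+-assoc k i j) (cong (_+_ k) i+j≡h)

∑-fold-even : ∀ h {f : ℕ → ℤ} → (∀ i j → i + j ≡ suc (h + h) → f i ≡ f j) →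
  ∑< (suc (suc (h + h))) f ≡ ∑< (suc h) f ℤ.+ ∑< (suc h) f
∑-fold-even h {f} f-sym = begin
  ∑< (suc (suc (h + h))) f                    ≡⟨ cong (λ m → ∑< (suc m) f) (ℕ.+-suc h h) ⟨
  ∑< (suc h + suc h) f                        ≡⟨ ∑-split (suc h) (suc h) f ⟩
  ∑< (suc h) f ℤ.+ ∑[ i < suc h ] f (suc h + i) ≡⟨ cong (ℤ._+_ (∑< (suc h) f)) (∑-reverse (suc h) mirror) ⟩
  ∑< (suc h) f ℤ.+ ∑< (suc h) f               ∎
  where
  open ≡-Reasoning
  mirror : ∀ i j → suc (i + j) ≡ suc h → f (suc h + i) ≡ f j
  mirror i j e = f-sym _ _ (shifted-pair (suc h) (ℕ.suc-injective e))

∑-fold-odd : ∀ h {f : ℕ → ℤ} → (∀ i j → i + j ≡ suc (suc (h + h)) → f i ≡ f j) → f (suc h) ≡ 0ℤ →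
  ∑< (suc (suc (suc (h + h)))) f ≡ ∑< (suc h) f ℤ.+ ∑< (suc h) f
∑-fold-odd h {f} f-sym f-mid = begin
  ∑< (suc (suc (suc (h + h)))) f
    ≡⟨ cong (λ m → ∑< (suc m) f) (trans (ℕ.+-suc h (suc h)) (cong suc (ℕ.+-suc h h))) ⟨
  ∑< (suc h + suc (suc h)) f
    ≡⟨ ∑-split (suc h) (suc (suc h)) f ⟩
  ∑< (suc h) f ℤ.+ (f (suc h + 0) ℤ.+ ∑[ i < suc h ] f (suc h + suc i))
    ≡⟨ cong (λ x → ∑< (suc h) f ℤ.+ (x ℤ.+ ∑[ i < suc h ] f (suc h + suc i)))
            (trans (cong f (ℕ.+-identityʳ (suc h))) f-mid) ⟩
  ∑< (suc h) f ℤ.+ (0ℤ ℤ.+ ∑[ i < suc h ] f (suc h + suc i))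
    ≡⟨ cong (ℤ._+_ (∑< (suc h) f)) (trans (ℤ.+-identityˡ _) (∑-reverse (suc h) mirror)) ⟩
  ∑< (suc h) f ℤ.+ ∑< (suc h) f ∎
  where
  open ≡-Reasoning
  mirror : ∀ i j → suc (i + j) ≡ suc h → f (suc h + suc i) ≡ f j
  mirror i j e = f-sym _ _ (trans (cong (_+ j) (ℕ.+-suc (suc h) i)) (shifted-pair (suc (suc h)) (ℕ.suc-injective e)))

-- Two-row characters

+m-+n≡+[m∸n] : ∀ {m n} → n ≤ m → + m ℤ.- + n ≡ + (m ∸ n)
+m-+n≡+[m∸n] {m} {n} n≤m = trans (ℤ.[+m]-[+n]≡m⊖n m n) (ℤ.⊖-≥ n≤m)

m<n⇒+m-+n≡-[1+n∸[1+m]] : ∀ {m n} → m < n → + m ℤ.- + n ≡ -[1+ n ∸ suc m ]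
m<n⇒+m-+n≡-[1+n∸[1+m]] {zero}  {suc n} _ = refl
m<n⇒+m-+n≡-[1+n∸[1+m]] {suc m} {suc n} (s≤s m<n) =
  trans (trans (ℤ.[1+m]⊖[1+n]≡m⊖n m n) (sym (ℤ.[+m]-[+n]≡m⊖n m n))) (m<n⇒+m-+n≡-[1+n∸[1+m]] m<n)

-- coeff μ J is the coefficient of xᴶ in (1 - x) ∏_{r ∈ μ} (1 + xʳ).
coeff : List ℕ → ℤ → ℤ
coeff []      (+ 0) = 1ℤ
coeff []      (+ 1) = -1ℤ
coeff []      _     = 0ℤ
coeff (r ∷ μ) J     = coeff μ J ℤ.+ coeff μ (J ℤ.- + r)

coeff-neg : ∀ μ t → coeff μ -[1+ t ] ≡ 0ℤ
coeff-neg []      t = refl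
coeff-neg (r ∷ μ) t =
  cong₂ ℤ._+_ (coeff-neg μ t) (trans (cong (coeff μ) (ℤ.neg-minus-pos t r)) (coeff-neg μ (r + t)))

coeff-below : ∀ μ {q r} → q < r → coeff μ (+ q ℤ.- + r) ≡ 0ℤ
coeff-below μ q<r = trans (cong (coeff μ) (m<n⇒+m-+n≡-[1+n∸[1+m]] q<r)) (coeff-neg μ _)

coeff-high : ∀ μ m → suc (size μ) < m → coeff μ (+ m) ≡ 0ℤ
coeff-high []      (suc (suc m)) _ = refl
coeff-high []      (suc zero) (s≤s ())
coeff-high (r ∷ μ) m s<m = cong₂ ℤ._+_
  (coeff-high μ m (ℕ.≤-<-trans (s≤s (ℕ.m≤n+m _ r)) s<m))
  (trans (cong (coeff μ) (+m-+n≡+[m∸n] r≤m)) (coeff-high μ (m ∸ r) s<m∸r))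
  where
  r≤m : r ≤ m
  r≤m = ℕ.≤-trans (ℕ.m≤m+n r _) (ℕ.≤-trans (ℕ.n≤1+n _) (ℕ.<⇒≤ s<m))
  s<m∸r : suc (size μ) < m ∸ r
  s<m∸r = ℕ.+-cancelˡ-< r _ _ (subst (r + suc (size μ) <_) (sym (ℕ.m+[n∸m]≡n r≤m))
                                     (subst (_< m) (sym (ℕ.+-suc r _)) s<m))

coeff-antisym : ∀ μ J → coeff μ (+ suc (size μ) ℤ.- J) ≡ ℤ.- coeff μ J
coeff-antisym []      (+ 0)           = refl
coeff-antisym []      (+ 1)           = refl
coeff-antisym []      (+ suc (suc _)) = refl
coeff-antisym []      -[1+ _ ]        = refl
coeff-antisym (r ∷ μ) J = begin
  coeff μ (M ℤ.- J) ℤ.+ coeff μ (M ℤ.- J ℤ.- + r)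
    ≡⟨ cong₂ (λ a b → coeff μ a ℤ.+ coeff μ b) reflect-shifted reflect ⟩
  coeff μ (+ suc (size μ) ℤ.- (J ℤ.- + r)) ℤ.+ coeff μ (+ suc (size μ) ℤ.- J)
    ≡⟨ cong₂ ℤ._+_ (coeff-antisym μ (J ℤ.- + r)) (coeff-antisym μ J) ⟩
  ℤ.- coeff μ (J ℤ.- + r) ℤ.+ ℤ.- coeff μ J
    ≡⟨ neg-+-swap (coeff μ (J ℤ.- + r)) (coeff μ J) ⟩
  ℤ.- (coeff μ J ℤ.+ coeff μ (J ℤ.- + r)) ∎
  where
  open ≡-Reasoning
  M = + suc (r + size μ)
  M≡ : M ≡ + r ℤ.+ + suc (size μ)
  M≡ = cong +_ (sym (ℕ.+-suc r (size μ)))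
  reflect-shifted : M ℤ.- J ≡ + suc (size μ) ℤ.- (J ℤ.- + r)
  reflect-shifted = trans (cong (ℤ._- J) M≡) (lemma (+ r) (+ suc (size μ)) J)
    where
    lemma : ∀ a b j → a ℤ.+ b ℤ.- j ≡ b ℤ.- (j ℤ.- a)
    lemma = solve-∀
  reflect : M ℤ.- J ℤ.- + r ≡ + suc (size μ) ℤ.- J
  reflect = trans (cong (λ m → m ℤ.- J ℤ.- + r) M≡) (lemma (+ r) (+ suc (size μ)) J)
    where
    lemma : ∀ a b j → a ℤ.+ b ℤ.- j ℤ.- a ≡ b ℤ.- j
    lemma = solve-∀
  neg-+-swap : ∀ a b → ℤ.- a ℤ.+ ℤ.- b ≡ ℤ.- (b ℤ.+ a)
  neg-+-swap = solve-∀

coeff-centre : ∀ μ q → q + q ≡ suc (size μ) → coeff μ (+ q) ≡ 0ℤ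
coeff-centre μ q 2q≡ = x≡-x⇒x≡0 (begin
  coeff μ (+ q)                    ≡⟨ cong (coeff μ) reflect ⟨
  coeff μ (+ suc (size μ) ℤ.- + q) ≡⟨ coeff-antisym μ (+ q) ⟩
  ℤ.- coeff μ (+ q)                ∎)
  where
  open ≡-Reasoning
  reflect : + suc (size μ) ℤ.- + q ≡ + q
  reflect = trans (+m-+n≡+[m∸n] (subst (q ≤_) 2q≡ (ℕ.m≤m+n q q)))
                  (cong +_ (trans (cong (_∸ q) (sym 2q≡)) (ℕ.m+n∸m≡n q q)))
  x≡-x⇒x≡0 : ∀ {x} → x ≡ ℤ.- x → x ≡ 0ℤ
  x≡-x⇒x≡0 {+ zero}   _  = refl
  x≡-x⇒x≡0 {+ suc _}  ()
  x≡-x⇒x≡0 { -[1+ _ ]} ()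

coeff-zero : ∀ μ → All (1 ≤_) μ → coeff μ (+ 0) ≡ 1ℤ
coeff-zero []            []       = refl
coeff-zero (suc r ∷ μ) (_ ∷ pos) = cong₂ ℤ._+_ (coeff-zero μ pos) (coeff-neg μ r)

module _ {m n : ℕ} where

  <ᵇ≡true : m < n → (m <ᵇ n) ≡ true
  <ᵇ≡true = det (ℕ.<ᵇ-reflects-< m n) ∘ ofʸ

  <ᵇ≡false : ¬ m < n → (m <ᵇ n) ≡ false
  <ᵇ≡false = det (ℕ.<ᵇ-reflects-< m n) ∘ ofⁿ

  ≤ᵇ≡true : m ≤ n → (m ≤ᵇ n) ≡ true
  ≤ᵇ≡true = det (ℕ.≤ᵇ-reflects-≤ m n) ∘ ofʸ

  ≤ᵇ≡false : ¬ m ≤ n → (m ≤ᵇ n) ≡ false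
  ≤ᵇ≡false = det (ℕ.≤ᵇ-reflects-≤ m n) ∘ ofⁿ

  ≡ᵇ≡true : m ≡ n → (m ≡ᵇ n) ≡ true
  ≡ᵇ≡true = det (fromEquivalence (ℕ.≡ᵇ⇒≡ m n) (ℕ.≡⇒≡ᵇ m n)) ∘ ofʸ

  ≡ᵇ≡false : m ≢ n → (m ≡ᵇ n) ≡ false
  ≡ᵇ≡false = det (fromEquivalence (ℕ.≡ᵇ⇒≡ m n) (ℕ.≡⇒≡ᵇ m n)) ∘ ofⁿ

member-∷-≡ : ∀ {x y} ys → x ≡ y → member x (y ∷ ys) ≡ true
member-∷-≡ ys x≡y rewrite ≡ᵇ≡true x≡y = refl

member-∷-≢ : ∀ {x y} ys → x ≢ y → member x (y ∷ ys) ≡ member x ys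
member-∷-≢ ys x≢y rewrite ≡ᵇ≡false x≢y = refl

replaceAt-∷-≡ : ∀ b b′ cs → replaceAt b b′ (b ∷ cs) ≡ b′ ∷ cs
replaceAt-∷-≡ b b′ cs rewrite ≡ᵇ≡true (refl {x = b}) = refl

replaceAt-∷-≢ : ∀ {b c} b′ cs → c ≢ b → replaceAt b b′ (c ∷ cs) ≡ c ∷ replaceAt b b′ cs
replaceAt-∷-≢ b′ cs c≢b rewrite ≡ᵇ≡false c≢b = refl

moveTerm : List ℕ → ℕ → ℕ → List ℕ → ℤ
moveTerm β r b μ =
  if (r ≤ᵇ b) ∧ not (member (b ∸ r) β)
    then signPow (countBetween (b ∸ r) b β) ℤ.* mnβ (replaceAt b (b ∸ r) β) μ
    else 0ℤ

mnβ-pair-∷ : ∀ p q r μ →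
  mnβ (p ∷ q ∷ []) (r ∷ μ) ≡ moveTerm (p ∷ q ∷ []) r p μ ℤ.+ (moveTerm (p ∷ q ∷ []) r q μ ℤ.+ 0ℤ)
mnβ-pair-∷ p q r μ = refl

moveTerm-blocked : ∀ β {r b} μ → b < r → moveTerm β r b μ ≡ 0ℤ
moveTerm-blocked β μ b<r rewrite ≤ᵇ≡false (ℕ.<⇒≱ b<r) = refl

moveTerm-occupied : ∀ β r b μ → member (b ∸ r) β ≡ true → moveTerm β r b μ ≡ 0ℤ
moveTerm-occupied β r b μ occ rewrite occ with r ≤ᵇ b
... | true  = refl
... | false = refl

moveTerm-free : ∀ β {r b} μ → r ≤ b → member (b ∸ r) β ≡ false →
  moveTerm β r b μ ≡ signPow (countBetween (b ∸ r) b β) ℤ.* mnβ (replaceAt b (b ∸ r) β) μ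
moveTerm-free β μ r≤b free rewrite ≤ᵇ≡true r≤b | free = refl

beadSign : ℕ → ℕ → ℤ
beadSign p q = if q <ᵇ p then 1ℤ else -1ℤ

sign-moveTerm-first : ∀ {p′ p q} → p′ < p → p′ ≢ q → p ≢ q →
  signPow (countBetween p′ p (p ∷ q ∷ [])) ℤ.* beadSign p′ q ≡ beadSign p q
sign-moveTerm-first {p′} {p} {q} p′<p p′≢q p≢q
  rewrite <ᵇ≡true p′<p | <ᵇ≡false (ℕ.<-irrefl (refl {x = p})) with ℕ.<-cmp p′ q
... | tri≈ _ p′≡q _ = contradiction p′≡q p′≢q
... | tri> _ _ q<p′ rewrite <ᵇ≡false (ℕ.<⇒≯ q<p′) | <ᵇ≡true q<p′ | <ᵇ≡true (ℕ.<-trans q<p′ p′<p) = refl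
... | tri< p′<q _ _ rewrite <ᵇ≡true p′<q | <ᵇ≡false (ℕ.<⇒≯ p′<q) with ℕ.<-cmp q p
...   | tri< q<p _ _ rewrite <ᵇ≡true q<p = refl
...   | tri≈ _ q≡p _ = contradiction (sym q≡p) p≢q
...   | tri> _ _ p<q rewrite <ᵇ≡false (ℕ.<⇒≯ p<q) = refl

sign-moveTerm-second : ∀ {p q′ q} → q′ < q → q′ ≢ p → p ≢ q →
  signPow (countBetween q′ q (p ∷ q ∷ [])) ℤ.* beadSign p q′ ≡ beadSign p q
sign-moveTerm-second {p} {q′} {q} q′<q q′≢p p≢q
  rewrite <ᵇ≡true q′<q | <ᵇ≡false (ℕ.<-irrefl (refl {x = q})) with ℕ.<-cmp q′ p
... | tri≈ _ q′≡p _ = contradiction q′≡p q′≢p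
... | tri> _ _ p<q′ rewrite <ᵇ≡false (ℕ.<⇒≯ p<q′) | <ᵇ≡false (ℕ.<⇒≯ (ℕ.<-trans p<q′ q′<q)) = refl
... | tri< q′<p _ _ rewrite <ᵇ≡true q′<p with ℕ.<-cmp p q
...   | tri< p<q _ _ rewrite <ᵇ≡true p<q | <ᵇ≡false (ℕ.<⇒≯ p<q) = refl
...   | tri≈ _ p≡q _ = contradiction p≡q p≢q
...   | tri> _ _ q<p rewrite <ᵇ≡false (ℕ.<⇒≯ q<p) | <ᵇ≡true q<p = refl

TwoBeadFormula : List ℕ → Set
TwoBeadFormula μ = ∀ p q → p + q ≡ suc (size μ) → p ≢ q →
  mnβ (p ∷ q ∷ []) μ ≡ beadSign p q ℤ.* coeff μ (+ q)

private
  0≡c*0 : ∀ c {x} → x ≡ 0ℤ → 0ℤ ≡ c ℤ.* x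
  0≡c*0 c x≡0 = sym (trans (cong (c ℤ.*_) x≡0) (ℤ.*-zeroʳ c))

  bead-lowered : ∀ {r s p q} → r ≤ p → p + q ≡ suc (r + s) → (p ∸ r) + q ≡ suc s
  bead-lowered {r} {s} {p} {q} r≤p pq = ℕ.+-cancelˡ-≡ r _ _ (begin
    r + ((p ∸ r) + q) ≡⟨ ℕ.+-assoc r (p ∸ r) q ⟨
    r + (p ∸ r) + q   ≡⟨ cong (_+ q) (ℕ.m+[n∸m]≡n r≤p) ⟩
    p + q             ≡⟨ pq ⟩
    suc (r + s)       ≡⟨ ℕ.+-suc r s ⟨
    r + suc s         ∎)
    where open ≡-Reasoning

  bead-blocked : ∀ {r s p q} → p < r → p + q ≡ suc (r + s) → suc s < q
  bead-blocked {r} {s} {p} {q} p<r pq = ℕ.+-cancelˡ-< r _ _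
    (subst (_< r + q) (trans pq (sym (ℕ.+-suc r s))) (ℕ.+-monoˡ-< q p<r))

  lowered< : ∀ {r b} → 1 ≤ r → r ≤ b → b ∸ r < b
  lowered< 1≤r r≤b = ℕ.∸-monoʳ-< 1≤r r≤b

moveTerm-first : ∀ {r μ p q} → 1 ≤ r → p + q ≡ suc (r + size μ) → p ≢ q → TwoBeadFormula μ →
  moveTerm (p ∷ q ∷ []) r p μ ≡ beadSign p q ℤ.* coeff μ (+ q)
moveTerm-first {r} {μ} {p} {q} 1≤r pq p≢q ih with r ℕ.≤? p
... | no r≰p = trans (moveTerm-blocked _ μ (ℕ.≰⇒> r≰p))
                     (0≡c*0 (beadSign p q) (coeff-high μ q (bead-blocked (ℕ.≰⇒> r≰p) pq)))
... | yes r≤p with p ∸ r ℕ.≟ q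
...   | yes p′≡q = trans (moveTerm-occupied _ r p μ (trans (member-∷-≢ (q ∷ []) p′≢p) (member-∷-≡ [] p′≡q)))
                         (0≡c*0 (beadSign p q) (coeff-centre μ q (subst (λ x → x + q ≡ _) p′≡q (bead-lowered r≤p pq))))
  where p′≢p = ℕ.<⇒≢ (lowered< 1≤r r≤p)
...   | no p′≢q = begin
  moveTerm (p ∷ q ∷ []) r p μ
    ≡⟨ moveTerm-free _ μ r≤p (trans (member-∷-≢ (q ∷ []) p′≢p) (member-∷-≢ [] p′≢q)) ⟩
  σ ℤ.* mnβ (replaceAt p p′ (p ∷ q ∷ [])) μ
    ≡⟨ cong (λ β → σ ℤ.* mnβ β μ) (replaceAt-∷-≡ p p′ _) ⟩
  σ ℤ.* mnβ (p′ ∷ q ∷ []) μ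
    ≡⟨ cong (σ ℤ.*_) (ih p′ q (bead-lowered r≤p pq) p′≢q) ⟩
  σ ℤ.* (beadSign p′ q ℤ.* coeff μ (+ q))
    ≡⟨ ℤ.*-assoc σ _ _ ⟨
  σ ℤ.* beadSign p′ q ℤ.* coeff μ (+ q)
    ≡⟨ cong (ℤ._* coeff μ (+ q)) (sign-moveTerm-first (lowered< 1≤r r≤p) p′≢q p≢q) ⟩
  beadSign p q ℤ.* coeff μ (+ q) ∎
  where
  open ≡-Reasoning
  p′ = p ∸ r
  p′≢p = ℕ.<⇒≢ (lowered< 1≤r r≤p)
  σ = signPow (countBetween p′ p (p ∷ q ∷ []))

moveTerm-second : ∀ {r μ p q} → 1 ≤ r → p + q ≡ suc (r + size μ) → p ≢ q → TwoBeadFormula μ →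
  moveTerm (p ∷ q ∷ []) r q μ ≡ beadSign p q ℤ.* coeff μ (+ q ℤ.- + r)
moveTerm-second {r} {μ} {p} {q} 1≤r pq p≢q ih with r ℕ.≤? q
... | no r≰q = trans (moveTerm-blocked _ μ (ℕ.≰⇒> r≰q)) (0≡c*0 (beadSign p q) (coeff-below μ (ℕ.≰⇒> r≰q)))
... | yes r≤q rewrite +m-+n≡+[m∸n] r≤q with q ∸ r ℕ.≟ p
...   | yes q′≡p = trans (moveTerm-occupied _ r q μ (member-∷-≡ (q ∷ []) q′≡p))
                         (0≡c*0 (beadSign p q) (trans (cong (coeff μ ∘ +_) q′≡p) (coeff-centre μ p centre)))
  where
  centre : p + p ≡ suc (size μ)
  centre = subst (λ x → x + p ≡ _) q′≡p (bead-lowered r≤q (trans (ℕ.+-comm q p) pq))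
...   | no q′≢p = begin
  moveTerm (p ∷ q ∷ []) r q μ
    ≡⟨ moveTerm-free _ μ r≤q (trans (member-∷-≢ (q ∷ []) q′≢p) (member-∷-≢ [] q′≢q)) ⟩
  σ ℤ.* mnβ (replaceAt q q′ (p ∷ q ∷ [])) μ
    ≡⟨ cong (λ β → σ ℤ.* mnβ β μ) (trans (replaceAt-∷-≢ q′ _ p≢q) (cong (p ∷_) (replaceAt-∷-≡ q q′ []))) ⟩
  σ ℤ.* mnβ (p ∷ q′ ∷ []) μ
    ≡⟨ cong (σ ℤ.*_) (ih p q′ p+q′ (q′≢p ∘ sym)) ⟩
  σ ℤ.* (beadSign p q′ ℤ.* coeff μ (+ q′))
    ≡⟨ ℤ.*-assoc σ _ _ ⟨
  σ ℤ.* beadSign p q′ ℤ.* coeff μ (+ q′)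
    ≡⟨ cong (ℤ._* coeff μ (+ q′)) (sign-moveTerm-second (lowered< 1≤r r≤q) q′≢p p≢q) ⟩
  beadSign p q ℤ.* coeff μ (+ q′) ∎
  where
  open ≡-Reasoning
  q′ = q ∸ r
  q′≢q = ℕ.<⇒≢ (lowered< 1≤r r≤q)
  σ = signPow (countBetween q′ q (p ∷ q ∷ []))
  p+q′ : p + q′ ≡ suc (size μ)
  p+q′ = trans (ℕ.+-comm p q′) (bead-lowered r≤q (trans (ℕ.+-comm q p) pq))

mnβ-twoBeads : ∀ μ → All (1 ≤_) μ → TwoBeadFormula μ
mnβ-twoBeads []      []         zero          (suc zero) _ _ = refl
mnβ-twoBeads []      []         (suc zero)    zero       _ _ = refl
mnβ-twoBeads []      []         zero          zero       () _
mnβ-twoBeads []      []         zero          (suc (suc _)) () _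
mnβ-twoBeads []      []         (suc zero)    (suc _)    () _
mnβ-twoBeads []      []         (suc (suc _)) _          () _
mnβ-twoBeads (r ∷ μ) (1≤r ∷ pos) p q pq p≢q = begin
  mnβ (p ∷ q ∷ []) (r ∷ μ)
    ≡⟨ mnβ-pair-∷ p q r μ ⟩
  moveTerm (p ∷ q ∷ []) r p μ ℤ.+ (moveTerm (p ∷ q ∷ []) r q μ ℤ.+ 0ℤ)
    ≡⟨ cong₂ ℤ._+_ (moveTerm-first {μ = μ} 1≤r pq p≢q ih)
                   (trans (ℤ.+-identityʳ _) (moveTerm-second {μ = μ} 1≤r pq p≢q ih)) ⟩
  beadSign p q ℤ.* coeff μ (+ q) ℤ.+ beadSign p q ℤ.* coeff μ (+ q ℤ.- + r)
    ≡⟨ ℤ.*-distribˡ-+ (beadSign p q) _ _ ⟨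
  beadSign p q ℤ.* coeff (r ∷ μ) (+ q) ∎
  where
  open ≡-Reasoning
  ih = mnβ-twoBeads μ pos

countBetween-own : ∀ {a b} → a < b → countBetween a b (b ∷ []) ≡ 0
countBetween-own {a} {b} a<b rewrite <ᵇ≡true a<b | <ᵇ≡false (ℕ.<-irrefl (refl {x = b})) = refl

mnβ-oneBead : ∀ μ → All (1 ≤_) μ → mnβ (size μ ∷ []) μ ≡ 1ℤ
mnβ-oneBead []      []          = refl
mnβ-oneBead (r ∷ μ) (1≤r ∷ pos) = begin
  moveTerm (b ∷ []) r b μ ℤ.+ 0ℤ
    ≡⟨ ℤ.+-identityʳ _ ⟩
  moveTerm (b ∷ []) r b μ
    ≡⟨ moveTerm-free (b ∷ []) μ (ℕ.m≤m+n r s) (member-∷-≢ [] (ℕ.<⇒≢ s′<b)) ⟩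
  signPow (countBetween s′ b (b ∷ [])) ℤ.* mnβ (replaceAt b s′ (b ∷ [])) μ
    ≡⟨ cong₂ (λ k β → signPow k ℤ.* mnβ β μ) (countBetween-own s′<b) (replaceAt-∷-≡ b s′ []) ⟩
  1ℤ ℤ.* mnβ (s′ ∷ []) μ
    ≡⟨ ℤ.*-identityˡ _ ⟩
  mnβ (s′ ∷ []) μ
    ≡⟨ cong (λ x → mnβ (x ∷ []) μ) (ℕ.m+n∸m≡n r s) ⟩
  mnβ (s ∷ []) μ
    ≡⟨ mnβ-oneBead μ pos ⟩
  1ℤ ∎
  where
  open ≡-Reasoning
  s = size μ
  b = r + s
  s′ = b ∸ r
  s′<b : s′ < b
  s′<b = lowered< 1≤r (ℕ.m≤m+n r s)

χ-twoRow : ∀ n μ j → All (1 ≤_) μ → size μ ≡ n → 2 * j ≤ n → χ (twoRow n j) μ ≡ coeff μ (+ j)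
χ-twoRow n μ zero pos refl _ = begin
  mnβ (size μ + 0 ∷ []) μ ≡⟨ cong (λ b → mnβ (b ∷ []) μ) (ℕ.+-identityʳ (size μ)) ⟩
  mnβ (size μ ∷ []) μ     ≡⟨ mnβ-oneBead μ pos ⟩
  1ℤ                      ≡⟨ coeff-zero μ pos ⟨
  coeff μ (+ 0)           ∎
  where open ≡-Reasoning
χ-twoRow n μ (suc j) pos refl 2j≤n = begin
  mnβ (p ∷ q ∷ []) μ           ≡⟨ mnβ-twoBeads μ pos p q p+q (ℕ.>⇒≢ q<p) ⟩
  beadSign p q ℤ.* coeff μ (+ q) ≡⟨ cong₂ (λ σ k → σ ℤ.* coeff μ (+ k))
                                           (cong (if_then 1ℤ else -1ℤ) (<ᵇ≡true q<p)) (ℕ.+-identityʳ (suc j)) ⟩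
  1ℤ ℤ.* coeff μ (+ suc j)     ≡⟨ ℤ.*-identityˡ _ ⟩
  coeff μ (+ suc j)            ∎
  where
  open ≡-Reasoning
  p = n ∸ suc j + 1
  q = suc j + 0
  [1+j]+[1+j]≤n : suc j + suc j ≤ n
  [1+j]+[1+j]≤n = subst (_≤ n) (cong (_+_ (suc j)) (ℕ.+-identityʳ (suc j))) 2j≤n
  1+j≤n : suc j ≤ n
  1+j≤n = ℕ.≤-trans (ℕ.m≤m+n (suc j) (suc j)) [1+j]+[1+j]≤n
  p+q : p + q ≡ suc n
  p+q = begin
    n ∸ suc j + 1 + (suc j + 0) ≡⟨ cong₂ _+_ (ℕ.+-comm (n ∸ suc j) 1) (ℕ.+-identityʳ (suc j)) ⟩
    suc (n ∸ suc j + suc j)     ≡⟨ cong suc (ℕ.m∸n+n≡m 1+j≤n) ⟩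
    suc n                       ∎
  q<p : q < p
  q<p = subst₂ _<_ (sym (ℕ.+-identityʳ (suc j))) (ℕ.+-comm 1 (n ∸ suc j))
    (s≤s (subst (_≤ n ∸ suc j) (ℕ.m+n∸n≡m (suc j) (suc j)) (ℕ.∸-monoˡ-≤ (suc j) [1+j]+[1+j]≤n)))

-- ψ as half a sum of squares

private
  m*2≡m+m : ∀ m → m * 2 ≡ m + m
  m*2≡m+m m = trans (ℕ.*-comm m 2) (cong (_+_ m) (ℕ.+-identityʳ m))

parity : ∀ n → n ≡ n / 2 + n / 2 ⊎ n ≡ suc (n / 2 + n / 2)
parity n with n % 2 | m%n<n n 2 | m≡m%n+[m/n]*n n 2
... | zero        | _            | n≡ = inj₁ (trans n≡ (m*2≡m+m (n / 2)))
... | suc zero    | _            | n≡ = inj₂ (trans n≡ (cong suc (m*2≡m+m (n / 2))))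
... | suc (suc _) | s≤s (s≤s ()) | _

coeff² : List ℕ → ℕ → ℤ
coeff² μ i = coeff μ (+ i) ℤ.* coeff μ (+ i)

coeff²-mirror : ∀ μ i j → i + j ≡ suc (size μ) → coeff² μ i ≡ coeff² μ j
coeff²-mirror μ i j i+j≡ = begin
  coeff μ (+ i) ℤ.* coeff μ (+ i)                 ≡⟨ square-neg (coeff μ (+ i)) ⟩
  ℤ.- coeff μ (+ i) ℤ.* ℤ.- coeff μ (+ i)         ≡⟨ cong (λ x → x ℤ.* x) (coeff-antisym μ (+ i)) ⟨
  coeff μ (+ suc (size μ) ℤ.- + i) ℤ.* coeff μ (+ suc (size μ) ℤ.- + i)
                                                  ≡⟨ cong (λ J → coeff μ J ℤ.* coeff μ J) reflect ⟩
  coeff μ (+ j) ℤ.* coeff μ (+ j)                 ∎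
  where
  open ≡-Reasoning
  square-neg : ∀ x → x ℤ.* x ≡ ℤ.- x ℤ.* ℤ.- x
  square-neg = solve-∀
  reflect : + suc (size μ) ℤ.- + i ≡ + j
  reflect = trans (+m-+n≡+[m∸n] (subst (i ≤_) i+j≡ (ℕ.m≤m+n i j)))
                  (cong +_ (trans (cong (_∸ i) (sym i+j≡)) (ℕ.m+n∸m≡n i j)))

ψ2≡∑coeff² : ∀ n μ → All (1 ≤_) μ → size μ ≡ n → ψ2 n μ ≡ ∑< (suc (n / 2)) (coeff² μ)
ψ2≡∑coeff² n μ pos sz =
  trans (foldr-map-applyUpTo (λ j → χ (twoRow n j) μ ℤ.* χ (twoRow n j) μ) (λ j → j) (suc (n / 2)))
        (∑-cong (suc (n / 2)) λ j j≤h → cong (λ x → x ℤ.* x) (χ-twoRow n μ j pos sz (2j≤n j (ℕ.≤-pred j≤h))))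
  where
  h+h≤n : n / 2 + n / 2 ≤ n
  h+h≤n with parity n
  ... | inj₁ n≡ = ℕ.≤-reflexive (sym n≡)
  ... | inj₂ n≡ = subst (n / 2 + n / 2 ≤_) (sym n≡) (ℕ.n≤1+n _)
  2j≤n : ∀ j → j ≤ n / 2 → 2 * j ≤ n
  2j≤n j j≤h = ℕ.≤-trans (ℕ.+-mono-≤ j≤h (ℕ.≤-trans (ℕ.≤-reflexive (ℕ.+-identityʳ j)) j≤h)) h+h≤n

∑coeff²≡ψ2+ψ2 : ∀ n μ → All (1 ≤_) μ → size μ ≡ n → ∑< (suc (suc n)) (coeff² μ) ≡ ψ2 n μ ℤ.+ ψ2 n μ
∑coeff²≡ψ2+ψ2 n μ pos sz = begin
  ∑< (suc (suc n)) (coeff² μ)                         ≡⟨ fold (parity n) ⟩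
  ∑< (suc h) (coeff² μ) ℤ.+ ∑< (suc h) (coeff² μ)     ≡⟨ cong₂ ℤ._+_ ψ≡ ψ≡ ⟨
  ψ2 n μ ℤ.+ ψ2 n μ                                   ∎
  where
  open ≡-Reasoning
  h = n / 2
  ψ≡ = ψ2≡∑coeff² n μ pos sz
  1+m≡1+size : ∀ {m} → n ≡ m → suc m ≡ suc (size μ)
  1+m≡1+size n≡m = cong suc (trans (sym n≡m) (sym sz))
  mirror : ∀ {m} → n ≡ m → ∀ i j → i + j ≡ suc m → coeff² μ i ≡ coeff² μ j
  mirror n≡m i j i+j≡ = coeff²-mirror μ i j (trans i+j≡ (1+m≡1+size n≡m))
  resize : ∀ {m} → n ≡ m → ∑< (suc (suc n)) (coeff² μ) ≡ ∑< (suc (suc m)) (coeff² μ)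
  resize = cong (λ m → ∑< (suc (suc m)) (coeff² μ))
  fold : n ≡ h + h ⊎ n ≡ suc (h + h) →
         ∑< (suc (suc n)) (coeff² μ) ≡ ∑< (suc h) (coeff² μ) ℤ.+ ∑< (suc h) (coeff² μ)
  fold (inj₁ n≡) = trans (resize n≡) (∑-fold-even h (mirror n≡))
  fold (inj₂ n≡) = trans (resize n≡) (∑-fold-odd h (mirror n≡)
    (cong (λ x → x ℤ.* x) (coeff-centre μ (suc h) (trans (cong suc (ℕ.+-suc h h)) (1+m≡1+size n≡)))))

size-replicate : ∀ N → size (replicate N 1) ≡ N
size-replicate zero    = refl
size-replicate (suc N) = cong suc (size-replicate N)

size-padOnes : ∀ μ₀ {n} → size μ₀ ≤ n → size (padOnes μ₀ n) ≡ n
size-padOnes μ₀ {n} k≤n = trans (sum-++ μ₀ (replicate (n ∸ size μ₀) 1))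
  (trans (cong (_+_ (size μ₀)) (size-replicate (n ∸ size μ₀))) (ℕ.m+[n∸m]≡n k≤n))

padOnes-positive : ∀ μ₀ n → All (1 ≤_) μ₀ → All (1 ≤_) (padOnes μ₀ n)
padOnes-positive μ₀ n pos = ++⁺ pos (ones (n ∸ size μ₀))
  where
  ones : ∀ N → All (1 ≤_) (replicate N 1)
  ones zero    = []
  ones (suc N) = s≤s z≤n ∷ ones N

-- Autocorrelation

-- The coefficient of xᵈ in U(x) U(x⁻¹) for U(x) = Σ coeff μ J xᴶ, whose support is [0, |μ| + 1].
autocorrelation : List ℕ → ℤ → ℤ
autocorrelation μ d = ∑[ i < suc (suc (size μ)) ] (coeff μ (+ i) ℤ.* coeff μ (+ i ℤ.+ d))

-- The coefficient of xᵈ in (1 + xʳ) (1 + x⁻ʳ) Σₑ f e xᵉ.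
spread : ℕ → (ℤ → ℤ) → ℤ → ℤ
spread r f d = (f d ℤ.+ f (d ℤ.- + r)) ℤ.+ (f (d ℤ.+ + r) ℤ.+ f d)

∑-window : ∀ (F : ℤ → ℤ) L → (∀ t → F -[1+ t ] ≡ 0ℤ) → (∀ t → F (+ (L + t)) ≡ 0ℤ) →
  ∀ a b → ∑[ i < a + (L + b) ] F (+ i ℤ.- + a) ≡ ∑[ i < L ] F (+ i)
∑-window F L F-neg F-high a b = begin
  ∑[ i < a + (L + b) ] F (+ i ℤ.- + a)
    ≡⟨ ∑-split a (L + b) _ ⟩
  ∑[ i < a ] F (+ i ℤ.- + a) ℤ.+ ∑[ i < L + b ] F (+ (a + i) ℤ.- + a)
    ≡⟨ cong₂ ℤ._+_ (∑-zero a below) (∑-cong (L + b) λ i _ → cong F (+m-+n≡+[m∸n] (ℕ.m≤m+n a i))) ⟩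
  0ℤ ℤ.+ ∑[ i < L + b ] F (+ (a + i ∸ a))
    ≡⟨ trans (ℤ.+-identityˡ _) (∑-cong (L + b) λ i _ → cong (λ k → F (+ k)) (ℕ.m+n∸m≡n a i)) ⟩
  ∑[ i < L + b ] F (+ i)
    ≡⟨ ∑-split L b _ ⟩
  ∑[ i < L ] F (+ i) ℤ.+ ∑[ i < b ] F (+ (L + i))
    ≡⟨ cong (ℤ._+_ (∑[ i < L ] F (+ i))) (∑-zero b λ i _ → F-high i) ⟩
  ∑[ i < L ] F (+ i) ℤ.+ 0ℤ
    ≡⟨ ℤ.+-identityʳ _ ⟩
  ∑[ i < L ] F (+ i) ∎
  where
  open ≡-Reasoning
  below : ∀ i → i < a → F (+ i ℤ.- + a) ≡ 0ℤ
  below i i<a = trans (cong F (m<n⇒+m-+n≡-[1+n∸[1+m]] i<a)) (F-neg _)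

autocorrelation-window : ∀ μ e a b {m} {g : ℕ → ℤ} → m ≡ a + (suc (suc (size μ)) + b) →
  (∀ i → g i ≡ coeff μ (+ i ℤ.- + a) ℤ.* coeff μ (+ i ℤ.- + a ℤ.+ e)) →
  ∑< m g ≡ autocorrelation μ e
autocorrelation-window μ e a b refl g≡ =
  trans (∑-cong (a + (suc (suc (size μ)) + b)) (λ i _ → g≡ i))
        (∑-window F _ (λ t → vanishes (coeff-neg μ t))
                      (λ t → vanishes (coeff-high μ _ (s≤s (s≤s (ℕ.m≤m+n (size μ) t))))) a b)
  where
  F : ℤ → ℤ
  F J = coeff μ J ℤ.* coeff μ (J ℤ.+ e)
  vanishes : ∀ {J} → coeff μ J ≡ 0ℤ → F J ≡ 0ℤ
  vanishes {J} coeff≡0 = trans (cong (ℤ._* coeff μ (J ℤ.+ e)) coeff≡0) (ℤ.*-zeroˡ (coeff μ (J ℤ.+ e)))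

autocorrelation-∷ : ∀ r μ d → autocorrelation (r ∷ μ) d ≡ spread r (autocorrelation μ) d
autocorrelation-∷ r μ d = begin
  ∑< m (λ i → (A i ℤ.+ B i) ℤ.* (C i ℤ.+ D i))
    ≡⟨ ∑-cong m (λ i _ → expand (A i) (B i) (C i) (D i)) ⟩
  ∑< m (λ i → (A i ℤ.* C i ℤ.+ A i ℤ.* D i) ℤ.+ (B i ℤ.* C i ℤ.+ B i ℤ.* D i))
    ≡⟨ ∑-+ m (λ i → A i ℤ.* C i ℤ.+ A i ℤ.* D i) (λ i → B i ℤ.* C i ℤ.+ B i ℤ.* D i) ⟩
  ∑< m (λ i → A i ℤ.* C i ℤ.+ A i ℤ.* D i) ℤ.+ ∑< m (λ i → B i ℤ.* C i ℤ.+ B i ℤ.* D i)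
    ≡⟨ cong₂ ℤ._+_ (∑-+ m (λ i → A i ℤ.* C i) (λ i → A i ℤ.* D i))
                   (∑-+ m (λ i → B i ℤ.* C i) (λ i → B i ℤ.* D i)) ⟩
  (∑< m (λ i → A i ℤ.* C i) ℤ.+ ∑< m (λ i → A i ℤ.* D i)) ℤ.+
  (∑< m (λ i → B i ℤ.* C i) ℤ.+ ∑< m (λ i → B i ℤ.* D i))
    ≡⟨ cong₂ ℤ._+_
         (cong₂ ℤ._+_ (autocorrelation-window μ d 0 r m≡0+ (λ i → cong₂ _*ᶜ_ (unshift i) (shift-d i)))
                      (autocorrelation-window μ (d ℤ.- + r) 0 r m≡0+ (λ i → cong₂ _*ᶜ_ (unshift i) (shift-d-r i))))
         (cong₂ ℤ._+_ (autocorrelation-window μ (d ℤ.+ + r) r 0 m≡r+ (λ i → cong₂ _*ᶜ_ refl (shift-d+r i)))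
                      (autocorrelation-window μ d r 0 m≡r+ (λ i → cong₂ _*ᶜ_ refl (shift-r-d i)))) ⟩
  spread r (autocorrelation μ) d ∎
  where
  open ≡-Reasoning
  s = size μ
  m = suc (suc (r + s))
  A B C D : ℕ → ℤ
  A i = coeff μ (+ i)
  B i = coeff μ (+ i ℤ.- + r)
  C i = coeff μ (+ i ℤ.+ d)
  D i = coeff μ (+ i ℤ.+ d ℤ.- + r)
  _*ᶜ_ : ℤ → ℤ → ℤ
  J *ᶜ K = coeff μ J ℤ.* coeff μ K
  expand : ∀ a b c e → (a ℤ.+ b) ℤ.* (c ℤ.+ e) ≡ (a ℤ.* c ℤ.+ a ℤ.* e) ℤ.+ (b ℤ.* c ℤ.+ b ℤ.* e)
  expand = solve-∀
  m≡0+ : m ≡ 0 + (suc (suc s) + r)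
  m≡0+ = cong (λ k → suc (suc k)) (ℕ.+-comm r s)
  m≡r+ : m ≡ r + (suc (suc s) + 0)
  m≡r+ = trans (cong suc (sym (ℕ.+-suc r s))) (trans (sym (ℕ.+-suc r (suc s))) (cong (_+_ r) (sym (ℕ.+-identityʳ _))))
  unshift : ∀ i → + i ≡ + i ℤ.- + 0
  unshift i = sym (ℤ.+-identityʳ (+ i))
  shift-d : ∀ i → + i ℤ.+ d ≡ + i ℤ.- + 0 ℤ.+ d
  shift-d i = cong (ℤ._+ d) (unshift i)
  shift-d-r : ∀ i → + i ℤ.+ d ℤ.- + r ≡ + i ℤ.- + 0 ℤ.+ (d ℤ.- + r)
  shift-d-r i = trans (ℤ.+-assoc (+ i) d _) (cong (ℤ._+ (d ℤ.- + r)) (unshift i))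
  shift-d+r : ∀ i → + i ℤ.+ d ≡ + i ℤ.- + r ℤ.+ (d ℤ.+ + r)
  shift-d+r i = lemma (+ i) d (+ r)
    where lemma : ∀ x d r → x ℤ.+ d ≡ x ℤ.- r ℤ.+ (d ℤ.+ r)
          lemma = solve-∀
  shift-r-d : ∀ i → + i ℤ.+ d ℤ.- + r ≡ + i ℤ.- + r ℤ.+ d
  shift-r-d i = lemma (+ i) d (+ r)
    where lemma : ∀ x d r → x ℤ.+ d ℤ.- r ≡ x ℤ.- r ℤ.+ d
          lemma = solve-∀

ψ2+ψ2≡autocorrelation : ∀ n μ → All (1 ≤_) μ → size μ ≡ n → ψ2 n μ ℤ.+ ψ2 n μ ≡ autocorrelation μ 0ℤ
ψ2+ψ2≡autocorrelation n μ pos refl = begin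
  ψ2 n μ ℤ.+ ψ2 n μ                     ≡⟨ ∑coeff²≡ψ2+ψ2 n μ pos refl ⟨
  ∑< (suc (suc n)) (coeff² μ)           ≡⟨ ∑-cong (suc (suc n)) (λ i _ → cong (λ J → coeff μ (+ i) ℤ.* coeff μ J)
                                                                       (sym (ℤ.+-identityʳ (+ i)))) ⟩
  autocorrelation μ 0ℤ                  ∎
  where open ≡-Reasoning

binomial : ℕ → ℤ → ℤ
binomial m (+ k)    = + (m C k)
binomial m -[1+ _ ] = 0ℤ

binomial-pascal : ∀ m y → binomial (suc m) y ≡ binomial m (y ℤ.- 1ℤ) ℤ.+ binomial m y
binomial-pascal m (+ zero)  = refl
binomial-pascal m (+ suc k) = cong +_ (sym (nCk+nC[k+1]≡[n+1]C[k+1] m k))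
binomial-pascal m -[1+ _ ]  = refl

-- The coefficient of xᵉ in (x + 2 + x⁻¹)ᴺ = (x^½ + x^-½)²ᴺ.
centred : ℕ → ℤ → ℤ
centred N e = binomial (2 * N) (+ N ℤ.+ e)

centred-suc : ∀ N e → centred (suc N) e ≡ spread 1 (centred N) e
centred-suc N e = begin
  binomial (2 * suc N) (+ suc N ℤ.+ e)
    ≡⟨ cong₂ binomial (cong suc (ℕ.+-suc N (N + 0))) (lemma₁ (+ N) e) ⟩
  binomial (suc (suc (2 * N))) (y ℤ.+ 1ℤ)
    ≡⟨ binomial-pascal (suc (2 * N)) (y ℤ.+ 1ℤ) ⟩
  binomial (suc (2 * N)) (y ℤ.+ 1ℤ ℤ.- 1ℤ) ℤ.+ binomial (suc (2 * N)) (y ℤ.+ 1ℤ)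
    ≡⟨ cong₂ ℤ._+_ (trans (cong (binomial (suc (2 * N))) (lemma₂ y)) (binomial-pascal (2 * N) y))
                   (binomial-pascal (2 * N) (y ℤ.+ 1ℤ)) ⟩
  (b (y ℤ.- 1ℤ) ℤ.+ b y) ℤ.+ (b (y ℤ.+ 1ℤ ℤ.- 1ℤ) ℤ.+ b (y ℤ.+ 1ℤ))
    ≡⟨ cong (λ z → (b (y ℤ.- 1ℤ) ℤ.+ b y) ℤ.+ (b z ℤ.+ b (y ℤ.+ 1ℤ))) (lemma₂ y) ⟩
  (b (y ℤ.- 1ℤ) ℤ.+ b y) ℤ.+ (b y ℤ.+ b (y ℤ.+ 1ℤ))
    ≡⟨ lemma₃ (b (y ℤ.- 1ℤ)) (b y) (b (y ℤ.+ 1ℤ)) ⟩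
  (b y ℤ.+ b (y ℤ.- 1ℤ)) ℤ.+ (b (y ℤ.+ 1ℤ) ℤ.+ b y)
    ≡⟨ cong₂ (λ u v → (b y ℤ.+ b u) ℤ.+ (b v ℤ.+ b y)) (ℤ.+-assoc (+ N) e -1ℤ) (ℤ.+-assoc (+ N) e 1ℤ) ⟩
  spread 1 (centred N) e ∎
  where
  open ≡-Reasoning
  y = + N ℤ.+ e
  b = binomial (2 * N)
  lemma₁ : ∀ n e → 1ℤ ℤ.+ n ℤ.+ e ≡ n ℤ.+ e ℤ.+ 1ℤ
  lemma₁ = solve-∀
  lemma₂ : ∀ y → y ℤ.+ 1ℤ ℤ.- 1ℤ ≡ y
  lemma₂ = solve-∀
  lemma₃ : ∀ a b c → (a ℤ.+ b) ℤ.+ (b ℤ.+ c) ≡ (b ℤ.+ a) ℤ.+ (c ℤ.+ b)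
  lemma₃ = solve-∀

-- A list of pairs (c , s) stands for the Laurent polynomial Σ c x⁻ˢ; translates ts f is the
-- coefficient sequence of its product with Σₑ f e xᵉ.
translates : List (ℤ × ℤ) → (ℤ → ℤ) → ℤ → ℤ
translates []             f d = 0ℤ
translates ((c , s) ∷ ts) f d = c ℤ.* f (d ℤ.+ s) ℤ.+ translates ts f d

translates-cong : ∀ ts {f g : ℤ → ℤ} → (∀ e → f e ≡ g e) → ∀ d → translates ts f d ≡ translates ts g d
translates-cong []             f≗g d = refl
translates-cong ((c , s) ∷ ts) f≗g d = cong₂ (λ x y → c ℤ.* x ℤ.+ y) (f≗g (d ℤ.+ s)) (translates-cong ts f≗g d)

spread-cong : ∀ r {f g : ℤ → ℤ} → (∀ e → f e ≡ g e) → ∀ d → spread r f d ≡ spread r g d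
spread-cong r f≗g d = cong₂ ℤ._+_ (cong₂ ℤ._+_ (f≗g d) (f≗g _)) (cong₂ ℤ._+_ (f≗g _) (f≗g d))

private
  sub-comm : ∀ d s r → d ℤ.+ s ℤ.- r ≡ d ℤ.- r ℤ.+ s
  sub-comm = solve-∀
  add-comm : ∀ d s r → d ℤ.+ s ℤ.+ r ≡ d ℤ.+ r ℤ.+ s
  add-comm = solve-∀
  sub-assoc : ∀ d s r → d ℤ.+ (s ℤ.- r) ≡ d ℤ.- r ℤ.+ s
  sub-assoc = solve-∀
  add-assoc : ∀ d s r → d ℤ.+ (s ℤ.+ r) ≡ d ℤ.+ r ℤ.+ s
  add-assoc = solve-∀

translates-spread : ∀ ts r f d → translates ts (spread r f) d ≡ spread r (translates ts f) d
translates-spread []             r f d = refl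
translates-spread ((c , s) ∷ ts) r f d
  rewrite translates-spread ts r f d | sub-comm d s (+ r) | add-comm d s (+ r) =
  distribute c (f (d ℤ.+ s)) (f (d ℤ.- + r ℤ.+ s)) (f (d ℤ.+ + r ℤ.+ s))
             (translates ts f d) (translates ts f (d ℤ.- + r)) (translates ts f (d ℤ.+ + r))
  where
  distribute : ∀ c a b e x y z → c ℤ.* ((a ℤ.+ b) ℤ.+ (e ℤ.+ a)) ℤ.+ ((x ℤ.+ y) ℤ.+ (z ℤ.+ x))
             ≡ (c ℤ.* a ℤ.+ x ℤ.+ (c ℤ.* b ℤ.+ y)) ℤ.+ ((c ℤ.* e ℤ.+ z) ℤ.+ (c ℤ.* a ℤ.+ x))
  distribute = solve-∀

spreadShifts : ℕ → List (ℤ × ℤ) → List (ℤ × ℤ)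
spreadShifts r []             = []
spreadShifts r ((c , s) ∷ ts) = (c , s) ∷ (c , s ℤ.- + r) ∷ (c , s ℤ.+ + r) ∷ (c , s) ∷ spreadShifts r ts

translates-spreadShifts : ∀ r ts f d → translates (spreadShifts r ts) f d ≡ spread r (translates ts f) d
translates-spreadShifts r []             f d = refl
translates-spreadShifts r ((c , s) ∷ ts) f d
  rewrite translates-spreadShifts r ts f d | sub-assoc d s (+ r) | add-assoc d s (+ r) =
  distribute c (f (d ℤ.+ s)) (f (d ℤ.- + r ℤ.+ s)) (f (d ℤ.+ + r ℤ.+ s))
             (translates ts f d) (translates ts f (d ℤ.- + r)) (translates ts f (d ℤ.+ + r))
  where
  distribute : ∀ c a b e x y z → c ℤ.* a ℤ.+ (c ℤ.* b ℤ.+ (c ℤ.* e ℤ.+ (c ℤ.* a ℤ.+ ((x ℤ.+ y) ℤ.+ (z ℤ.+ x)))))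
             ≡ (c ℤ.* a ℤ.+ x ℤ.+ (c ℤ.* b ℤ.+ y)) ℤ.+ ((c ℤ.* e ℤ.+ z) ℤ.+ (c ℤ.* a ℤ.+ x))
  distribute = solve-∀

baseShifts : List (ℤ × ℤ)
baseShifts = (+ 2 , 0ℤ) ∷ (-1ℤ , 1ℤ) ∷ (-1ℤ , -1ℤ) ∷ []

autocorrelation-[] : ∀ d → autocorrelation [] d ≡ translates baseShifts (centred 0) d
autocorrelation-[] (+ 0)                = refl
autocorrelation-[] (+ 1)                = refl
autocorrelation-[] (+ suc (suc _))      = refl
autocorrelation-[] -[1+ 0 ]             = refl
autocorrelation-[] -[1+ 1 ]             = refl
autocorrelation-[] -[1+ suc (suc _) ]   = refl

shiftsOf : List ℕ → List (ℤ × ℤ)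
shiftsOf []      = baseShifts
shiftsOf (r ∷ μ) = spreadShifts r (shiftsOf μ)

autocorrelation-ones : ∀ N d → autocorrelation (replicate N 1) d ≡ translates baseShifts (centred N) d
autocorrelation-ones zero    d = autocorrelation-[] d
autocorrelation-ones (suc N) d = begin
  autocorrelation (1 ∷ replicate N 1) d                ≡⟨ autocorrelation-∷ 1 (replicate N 1) d ⟩
  spread 1 (autocorrelation (replicate N 1)) d         ≡⟨ spread-cong 1 (autocorrelation-ones N) d ⟩
  spread 1 (translates baseShifts (centred N)) d       ≡⟨ translates-spread baseShifts 1 (centred N) d ⟨
  translates baseShifts (spread 1 (centred N)) d       ≡⟨ translates-cong baseShifts (λ e → sym (centred-suc N e)) d ⟩
  translates baseShifts (centred (suc N)) d            ∎
  where open ≡-Reasoning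

autocorrelation-padded : ∀ μ₀ N d →
  autocorrelation (μ₀ ++ replicate N 1) d ≡ translates (shiftsOf μ₀) (centred N) d
autocorrelation-padded []      N d = autocorrelation-ones N d
autocorrelation-padded (r ∷ μ) N d = begin
  autocorrelation (r ∷ μ ++ replicate N 1) d                 ≡⟨ autocorrelation-∷ r (μ ++ replicate N 1) d ⟩
  spread r (autocorrelation (μ ++ replicate N 1)) d          ≡⟨ spread-cong r (autocorrelation-padded μ N) d ⟩
  spread r (translates (shiftsOf μ) (centred N)) d           ≡⟨ translates-spreadShifts r (shiftsOf μ) (centred N) d ⟨
  translates (spreadShifts r (shiftsOf μ)) (centred N) d     ∎
  where open ≡-Reasoning

ShiftsBounded : ℕ → List (ℤ × ℤ) → Set
ShiftsBounded K = All (λ cs → ℤ.∣ proj₂ cs ∣ ≤ K)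

spreadShifts-bounded : ∀ r {K} ts → ShiftsBounded K ts → ShiftsBounded (r + K) (spreadShifts r ts)
spreadShifts-bounded r []             []          = []
spreadShifts-bounded r ((c , s) ∷ ts) (∣s∣≤K ∷ bs) =
  ∣s∣≤r+K ∷ ℕ.≤-trans (ℤ.∣i-j∣≤∣i∣+∣j∣ s (+ r)) ∣s∣+r≤r+K
          ∷ ℕ.≤-trans (ℤ.∣i+j∣≤∣i∣+∣j∣ s (+ r)) ∣s∣+r≤r+K
          ∷ ∣s∣≤r+K ∷ spreadShifts-bounded r ts bs
  where
  ∣s∣≤r+K = ℕ.≤-trans ∣s∣≤K (ℕ.m≤n+m _ r)
  ∣s∣+r≤r+K = subst (ℤ.∣ s ∣ + r ≤_) (ℕ.+-comm _ r) (ℕ.+-monoˡ-≤ r ∣s∣≤K)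

shiftsOf-bounded : ∀ μ₀ → ShiftsBounded (suc (size μ₀)) (shiftsOf μ₀)
shiftsOf-bounded []      = z≤n ∷ s≤s z≤n ∷ s≤s z≤n ∷ []
shiftsOf-bounded (r ∷ μ) = subst (λ K → ShiftsBounded K (shiftsOf (r ∷ μ))) (ℕ.+-suc r (size μ))
  (spreadShifts-bounded r (shiftsOf μ) (shiftsOf-bounded μ))

-- Factorial identities

P′-vanishes : ∀ {L a} → L < a → L P′ a ≡ 0
P′-vanishes {L} {suc a} L<1+a with ℕ.m≤n⇒m<n∨m≡n (s≤s⁻¹ L<1+a)
... | inj₁ L<a  = trans (cong ((L ∸ a) *_) (P′-vanishes L<a)) (ℕ.*-zeroʳ (L ∸ a))
... | inj₂ refl = cong (_* (L P′ L)) (ℕ.n∸n≡0 L)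

P′*!≡! : ∀ {L} a i → i + a ≡ L → (L P′ a) * i ! ≡ L !
P′*!≡! {L} zero    i i+0≡L = trans (ℕ.*-identityˡ (i !)) (cong _! (trans (sym (ℕ.+-identityʳ i)) i+0≡L))
P′*!≡! {L} (suc a) i i+1+a≡L = begin
  (L ∸ a) * (L P′ a) * i !   ≡⟨ cong (λ x → x * (L P′ a) * i !) L∸a≡1+i ⟩
  suc i * (L P′ a) * i !     ≡⟨ swap (suc i) (L P′ a) (i !) ⟩
  (L P′ a) * (suc i) !       ≡⟨ P′*!≡! a (suc i) (trans (sym (ℕ.+-suc i a)) i+1+a≡L) ⟩
  L !                        ∎
  where
  open ≡-Reasoning
  L∸a≡1+i : L ∸ a ≡ suc i
  L∸a≡1+i = trans (cong (_∸ a) (trans (sym i+1+a≡L) (ℕ.+-suc i a))) (ℕ.m+n∸n≡m (suc i) a)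
  swap : ∀ x y z → x * y * z ≡ y * (x * z)
  swap = ℕ-Solver.solve-∀

C*!!≡! : ∀ i j → ((i + j) C i) * (i ! * j !) ≡ (i + j) !
C*!!≡! i j = begin
  ((i + j) C i) * (i ! * j !)           ≡⟨ cong (λ k → ((i + j) C i) * (i ! * k !)) (ℕ.m+n∸m≡n i j) ⟨
  ((i + j) C i) * (i ! * (i + j ∸ i) !) ≡⟨ trans (cong (_* (i ! * (i + j ∸ i) !)) (nCk≡n!/k![n-k]! (ℕ.m≤m+n i j)))
                                                   (m/n*n≡m {{i !* (i + j ∸ i) !≢0}} (k![n∸k]!∣n! (ℕ.m≤m+n i j))) ⟩
  (i + j) !                             ∎
  where open ≡-Reasoning

C*P′≡C*P′*P′ : ∀ {L} i j a b → i + a ≡ L → j + b ≡ L →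
  ((i + j) C i) * ((L + L) P′ (a + b)) ≡ ((L + L) C L) * ((L P′ a) * (L P′ b))
C*P′≡C*P′*P′ {L} i j a b i+a≡L j+b≡L = ℕ.*-cancelʳ-≡ _ _ (i ! * j !) {{i !* j !≢0}} (begin
  ((i + j) C i) * ((L + L) P′ (a + b)) * (i ! * j !)
    ≡⟨ swap ((i + j) C i) ((L + L) P′ (a + b)) (i ! * j !) ⟩
  ((L + L) P′ (a + b)) * (((i + j) C i) * (i ! * j !))
    ≡⟨ cong (((L + L) P′ (a + b)) *_) (C*!!≡! i j) ⟩
  ((L + L) P′ (a + b)) * (i + j) !
    ≡⟨ P′*!≡! (a + b) (i + j) (trans (interchange i j a b) (cong₂ _+_ i+a≡L j+b≡L)) ⟩
  (L + L) !
    ≡⟨ C*!!≡! L L ⟨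
  ((L + L) C L) * (L ! * L !)
    ≡⟨ cong₂ (λ x y → ((L + L) C L) * (x * y)) (P′*!≡! a i i+a≡L) (P′*!≡! b j j+b≡L) ⟨
  ((L + L) C L) * ((L P′ a) * i ! * ((L P′ b) * j !))
    ≡⟨ regroup ((L + L) C L) (L P′ a) (i !) (L P′ b) (j !) ⟩
  ((L + L) C L) * ((L P′ a) * (L P′ b)) * (i ! * j !) ∎)
  where
  open ≡-Reasoning
  swap : ∀ x y z → x * y * z ≡ y * (x * z)
  swap = ℕ-Solver.solve-∀
  interchange : ∀ i j a b → i + j + (a + b) ≡ i + a + (j + b)
  interchange = ℕ-Solver.solve-∀
  regroup : ∀ c x y u v → c * (x * y * (u * v)) ≡ c * (x * u) * (y * v)
  regroup = ℕ-Solver.solve-∀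

central-binomial-suc : ∀ n → ((suc n + suc n) C suc n) * suc n ≡ 2 * (2 * n + 1) * ((n + n) C n)
central-binomial-suc n = ℕ.*-cancelʳ-≡ _ _ (n ! * n ! * suc n) {{nonZero}} (begin
  ((L + L) C L) * L * (n ! * n ! * L)
    ≡⟨ regroup₁ ((L + L) C L) n (n !) ⟩
  ((L + L) C L) * (L ! * L !)
    ≡⟨ C*!!≡! L L ⟩
  (L + L) !
    ≡⟨ cong _! (cong suc (ℕ.+-suc n n)) ⟩
  suc (suc (n + n)) * (suc (n + n) * (n + n) !)
    ≡⟨ cong (λ x → suc (suc (n + n)) * (suc (n + n) * x)) (C*!!≡! n n) ⟨
  suc (suc (n + n)) * (suc (n + n) * (((n + n) C n) * (n ! * n !)))
    ≡⟨ regroup₂ n ((n + n) C n) (n !) ⟩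
  2 * (2 * n + 1) * ((n + n) C n) * (n ! * n ! * L) ∎)
  where
  open ≡-Reasoning
  L = suc n
  nonZero = ℕ.m*n≢0 (n ! * n !) (suc n) {{n !* n !≢0}}
  regroup₁ : ∀ c n f → c * suc n * (f * f * suc n) ≡ c * (suc n * f * (suc n * f))
  regroup₁ = ℕ-Solver.solve-∀
  regroup₂ : ∀ n c f → suc (suc (n + n)) * (suc (n + n) * (c * (f * f))) ≡ 2 * (2 * n + 1) * c * (f * f * suc n)
  regroup₂ = ℕ-Solver.solve-∀

C*P′-ratio : ∀ {n} i j a b → i + a ≡ suc n → j + b ≡ suc n →
  ((i + j) C i) * (suc n * ((suc n + suc n) P′ (a + b)))
    ≡ ((n + n) C n) * (2 * (2 * n + 1) * ((suc n P′ a) * (suc n P′ b)))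
C*P′-ratio {n} i j a b i+a≡L j+b≡L = begin
  ((i + j) C i) * (L * ((L + L) P′ (a + b)))
    ≡⟨ swap ((i + j) C i) L ((L + L) P′ (a + b)) ⟩
  ((i + j) C i) * ((L + L) P′ (a + b)) * L
    ≡⟨ cong (_* L) (C*P′≡C*P′*P′ i j a b i+a≡L j+b≡L) ⟩
  ((L + L) C L) * ((L P′ a) * (L P′ b)) * L
    ≡⟨ exchange ((L + L) C L) ((L P′ a) * (L P′ b)) L ⟩
  ((L + L) C L) * L * ((L P′ a) * (L P′ b))
    ≡⟨ cong (_* ((L P′ a) * (L P′ b))) (central-binomial-suc n) ⟩
  2 * (2 * n + 1) * ((n + n) C n) * ((L P′ a) * (L P′ b))
    ≡⟨ regroup (2 * (2 * n + 1)) ((n + n) C n) ((L P′ a) * (L P′ b)) ⟩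
  ((n + n) C n) * (2 * (2 * n + 1) * ((L P′ a) * (L P′ b))) ∎
  where
  open ≡-Reasoning
  L = suc n
  swap : ∀ c x y → c * (x * y) ≡ c * y * x
  swap = ℕ-Solver.solve-∀
  exchange : ∀ c x y → c * x * y ≡ c * y * x
  exchange = ℕ-Solver.solve-∀
  regroup : ∀ c d x → c * d * x ≡ d * (c * x)
  regroup = ℕ-Solver.solve-∀

P′-nonzero : ∀ {L a} → a ≤ L → (L P′ a) ≢ 0
P′-nonzero {L} {a} a≤L P′≡0 = ℕ.<⇒≢ (ℕ.1≤n! L)
  (trans (sym (cong (_* (L ∸ a) !) P′≡0)) (P′*!≡! a (L ∸ a) (ℕ.m∸n+n≡m a≤L)))

-- Polynomials

eval : List ℤ → ℕ → ℤ
eval []       n = 0ℤ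
eval (c ∷ cs) n = c ℤ.+ + n ℤ.* eval cs n

infixl 6 _⊕_
infixl 7 _⊛_

_⊕_ : List ℤ → List ℤ → List ℤ
[]       ⊕ q        = q
(a ∷ p)  ⊕ []       = a ∷ p
(a ∷ p)  ⊕ (b ∷ q)  = (a ℤ.+ b) ∷ (p ⊕ q)

scale : ℤ → List ℤ → List ℤ
scale c []       = []
scale c (a ∷ p)  = (c ℤ.* a) ∷ scale c p

_⊛_ : List ℤ → List ℤ → List ℤ
[]      ⊛ q = []
(a ∷ p) ⊛ q = scale a q ⊕ (0ℤ ∷ p ⊛ q)

eval-⊕ : ∀ p q n → eval (p ⊕ q) n ≡ eval p n ℤ.+ eval q n
eval-⊕ []      q       n = sym (ℤ.+-identityˡ _)
eval-⊕ (a ∷ p) []      n = sym (ℤ.+-identityʳ _)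
eval-⊕ (a ∷ p) (b ∷ q) n = trans (cong (λ x → a ℤ.+ b ℤ.+ + n ℤ.* x) (eval-⊕ p q n)) (regroup a b (+ n) _ _)
  where
  regroup : ∀ a b x u v → a ℤ.+ b ℤ.+ x ℤ.* (u ℤ.+ v) ≡ a ℤ.+ x ℤ.* u ℤ.+ (b ℤ.+ x ℤ.* v)
  regroup = solve-∀

eval-scale : ∀ c p n → eval (scale c p) n ≡ c ℤ.* eval p n
eval-scale c []      n = sym (ℤ.*-zeroʳ c)
eval-scale c (a ∷ p) n = trans (cong (λ x → c ℤ.* a ℤ.+ + n ℤ.* x) (eval-scale c p n)) (regroup c a (+ n) _)
  where
  regroup : ∀ c a x u → c ℤ.* a ℤ.+ x ℤ.* (c ℤ.* u) ≡ c ℤ.* (a ℤ.+ x ℤ.* u)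
  regroup = solve-∀

eval-⊛ : ∀ p q n → eval (p ⊛ q) n ≡ eval p n ℤ.* eval q n
eval-⊛ []      q n = refl
eval-⊛ (a ∷ p) q n = begin
  eval (scale a q ⊕ (0ℤ ∷ p ⊛ q)) n             ≡⟨ eval-⊕ (scale a q) (0ℤ ∷ p ⊛ q) n ⟩
  eval (scale a q) n ℤ.+ (0ℤ ℤ.+ + n ℤ.* eval (p ⊛ q) n)
    ≡⟨ cong₂ (λ x y → x ℤ.+ (0ℤ ℤ.+ + n ℤ.* y)) (eval-scale a q n) (eval-⊛ p q n) ⟩
  a ℤ.* eval q n ℤ.+ (0ℤ ℤ.+ + n ℤ.* (eval p n ℤ.* eval q n))
    ≡⟨ regroup a (+ n) (eval p n) (eval q n) ⟩
  (a ℤ.+ + n ℤ.* eval p n) ℤ.* eval q n         ∎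
  where
  open ≡-Reasoning
  regroup : ∀ a x u v → a ℤ.* v ℤ.+ (0ℤ ℤ.+ x ℤ.* (u ℤ.* v)) ≡ (a ℤ.+ x ℤ.* u) ℤ.* v
  regroup = solve-∀

linear : ℕ → ℕ → List ℤ
linear α β = + β ∷ + α ∷ []

eval-linear : ∀ α β n → eval (linear α β) n ≡ + (α * n + β)
eval-linear α β n = begin
  + β ℤ.+ + n ℤ.* (+ α ℤ.+ + n ℤ.* 0ℤ) ≡⟨ regroup (+ β) (+ n) (+ α) ⟩
  + α ℤ.* + n ℤ.+ + β                 ≡⟨ cong (ℤ._+ + β) (ℤ.pos-* α n) ⟨
  + (α * n) ℤ.+ + β                   ≡⟨ ℤ.pos-+ (α * n) β ⟨
  + (α * n + β)                       ∎
  where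
  open ≡-Reasoning
  regroup : ∀ b x a → b ℤ.+ x ℤ.* (a ℤ.+ x ℤ.* 0ℤ) ≡ a ℤ.* x ℤ.+ b
  regroup = solve-∀

falling : List ℤ → ℕ → List ℤ
falling p zero    = 1ℤ ∷ []
falling p (suc a) = (p ⊕ (ℤ.- + a ∷ [])) ⊛ falling p a

eval-falling : ∀ p a n {m} → eval p n ≡ + m → eval (falling p a) n ≡ + (m P′ a)
eval-falling p zero    n p≡m = cong (ℤ._+_ 1ℤ) (ℤ.*-zeroʳ (+ n))
eval-falling p (suc a) n {m} p≡m = begin
  eval ((p ⊕ (ℤ.- + a ∷ [])) ⊛ falling p a) n
    ≡⟨ eval-⊛ (p ⊕ (ℤ.- + a ∷ [])) (falling p a) n ⟩
  eval (p ⊕ (ℤ.- + a ∷ [])) n ℤ.* eval (falling p a) n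
    ≡⟨ cong₂ ℤ._*_ (trans (eval-⊕ p _ n) (cong₂ ℤ._+_ p≡m eval-constant)) (eval-falling p a n p≡m) ⟩
  (+ m ℤ.- + a) ℤ.* + (m P′ a)
    ≡⟨ factor ⟩
  + ((m ∸ a) * (m P′ a)) ∎
  where
  open ≡-Reasoning
  eval-constant : eval (ℤ.- + a ∷ []) n ≡ ℤ.- + a
  eval-constant = trans (cong (ℤ._+_ (ℤ.- + a)) (ℤ.*-zeroʳ (+ n))) (ℤ.+-identityʳ (ℤ.- + a))
  factor : (+ m ℤ.- + a) ℤ.* + (m P′ a) ≡ + ((m ∸ a) * (m P′ a))
  factor with a ℕ.≤? m
  ... | yes a≤m = trans (cong (ℤ._* + (m P′ a)) (+m-+n≡+[m∸n] a≤m)) (sym (ℤ.pos-* (m ∸ a) (m P′ a)))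
  ... | no  a≰m rewrite P′-vanishes (ℕ.≰⇒> a≰m) = trans (ℤ.*-zeroʳ (+ m ℤ.- + a)) (cong +_ (sym (ℕ.*-zeroʳ (m ∸ a))))

denominator : ℕ → List ℤ
denominator K = linear 1 1 ⊛ falling (linear 2 2) (K + K)

numerator : ℕ → ℤ → List ℤ
numerator K s = linear 4 2 ⊛ (falling (linear 1 1) ℤ.∣ + K ℤ.- s ∣ ⊛ falling (linear 1 1) ℤ.∣ + K ℤ.+ s ∣)

private
  1n+1≡1+n : ∀ n → 1 * n + 1 ≡ suc n
  1n+1≡1+n = ℕ-Solver.solve-∀
  2n+2≡1+n+1+n : ∀ n → 2 * n + 2 ≡ suc n + suc n
  2n+2≡1+n+1+n = ℕ-Solver.solve-∀
  4n+2≡2[2n+1] : ∀ n → 4 * n + 2 ≡ 2 * (2 * n + 1)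
  4n+2≡2[2n+1] = ℕ-Solver.solve-∀

eval-denominator : ∀ K n → eval (denominator K) n ≡ + (suc n * ((suc n + suc n) P′ (K + K)))
eval-denominator K n = begin
  eval (linear 1 1 ⊛ falling (linear 2 2) (K + K)) n
    ≡⟨ eval-⊛ (linear 1 1) (falling (linear 2 2) (K + K)) n ⟩
  eval (linear 1 1) n ℤ.* eval (falling (linear 2 2) (K + K)) n
    ≡⟨ cong₂ ℤ._*_ (trans (eval-linear 1 1 n) (cong +_ (1n+1≡1+n n)))
                   (eval-falling (linear 2 2) (K + K) n (trans (eval-linear 2 2 n) (cong +_ (2n+2≡1+n+1+n n)))) ⟩
  + suc n ℤ.* + ((suc n + suc n) P′ (K + K))
    ≡⟨ ℤ.pos-* (suc n) _ ⟨
  + (suc n * ((suc n + suc n) P′ (K + K))) ∎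
  where open ≡-Reasoning

eval-numerator : ∀ K s n → eval (numerator K s) n
  ≡ + (2 * (2 * n + 1) * ((suc n P′ ℤ.∣ + K ℤ.- s ∣) * (suc n P′ ℤ.∣ + K ℤ.+ s ∣)))
eval-numerator K s n = begin
  eval (linear 4 2 ⊛ (falling (linear 1 1) a ⊛ falling (linear 1 1) b)) n
    ≡⟨ eval-⊛ (linear 4 2) (falling (linear 1 1) a ⊛ falling (linear 1 1) b) n ⟩
  eval (linear 4 2) n ℤ.* eval (falling (linear 1 1) a ⊛ falling (linear 1 1) b) n
    ≡⟨ cong (eval (linear 4 2) n ℤ.*_) (eval-⊛ (falling (linear 1 1) a) (falling (linear 1 1) b) n) ⟩
  eval (linear 4 2) n ℤ.* (eval (falling (linear 1 1) a) n ℤ.* eval (falling (linear 1 1) b) n)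
    ≡⟨ cong₂ ℤ._*_ (trans (eval-linear 4 2 n) (cong +_ (4n+2≡2[2n+1] n)))
                   (cong₂ ℤ._*_ (eval-falling (linear 1 1) a n L≡) (eval-falling (linear 1 1) b n L≡)) ⟩
  + (2 * (2 * n + 1)) ℤ.* (+ (suc n P′ a) ℤ.* + (suc n P′ b))
    ≡⟨ cong (+ (2 * (2 * n + 1)) ℤ.*_) (ℤ.pos-* (suc n P′ a) _) ⟨
  + (2 * (2 * n + 1)) ℤ.* + ((suc n P′ a) * (suc n P′ b))
    ≡⟨ ℤ.pos-* (2 * (2 * n + 1)) _ ⟨
  + (2 * (2 * n + 1) * ((suc n P′ a) * (suc n P′ b))) ∎
  where
  open ≡-Reasoning
  a = ℤ.∣ + K ℤ.- s ∣
  b = ℤ.∣ + K ℤ.+ s ∣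
  L≡ : eval (linear 1 1) n ≡ + suc n
  L≡ = trans (eval-linear 1 1 n) (cong +_ (1n+1≡1+n n))

private
  i+j≡N+N : ∀ {L} N K i j a b → N + K ≡ L → i + a ≡ L → j + b ≡ L → a + b ≡ K + K → i + j ≡ N + N
  i+j≡N+N {L} N K i j a b N+K≡L i+a≡L j+b≡L a+b≡2K = ℕ.+-cancelʳ-≡ (a + b) (i + j) (N + N) (begin
    i + j + (a + b)       ≡⟨ interchange i j a b ⟩
    i + a + (j + b)       ≡⟨ cong₂ _+_ i+a≡L j+b≡L ⟩
    L + L                 ≡⟨ cong₂ _+_ N+K≡L N+K≡L ⟨
    N + K + (N + K)       ≡⟨ interchange N K N K ⟩
    N + N + (K + K)       ≡⟨ cong (_+_ (N + N)) a+b≡2K ⟨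
    N + N + (a + b)       ∎)
    where
    open ≡-Reasoning
    interchange : ∀ w x y z → w + x + (y + z) ≡ w + y + (x + z)
    interchange = ℕ-Solver.solve-∀

  N+N<i : ∀ {L} N K i a b → N + K ≡ L → i + a ≡ L → L < b → a + b ≡ K + K → N + N < i
  N+N<i {L} N K i a b N+K≡L i+a≡L L<b a+b≡2K = ℕ.+-cancelʳ-< (a + b) (N + N) i (begin-strict
    N + N + (a + b)       ≡⟨ cong (_+_ (N + N)) a+b≡2K ⟩
    N + N + (K + K)       ≡⟨ interchange N N K K ⟩
    N + K + (N + K)       ≡⟨ cong₂ _+_ N+K≡L N+K≡L ⟩
    L + L                 <⟨ ℕ.+-monoʳ-< L L<b ⟩
    L + b                 ≡⟨ cong (_+ b) i+a≡L ⟨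
    i + a + b             ≡⟨ ℕ.+-assoc i a b ⟩
    i + (a + b)           ∎)
    where
    open ℕ.≤-Reasoning
    interchange : ∀ w x y z → w + x + (y + z) ≡ w + y + (x + z)
    interchange = ℕ-Solver.solve-∀

private
  scaled-zero : ∀ n {x} → x ≡ 0 → 0ℤ ≡ + ((n + n) C n) ℤ.* + (2 * (2 * n + 1) * x)
  scaled-zero n refl rewrite ℕ.*-zeroʳ (2 * (2 * n + 1)) = sym (ℤ.*-zeroʳ (+ ((n + n) C n)))

binomial-rational : ∀ {n} N K a b → N + K ≡ suc n → a + b ≡ K + K →
  binomial (N + N) (+ suc n ℤ.- + a) ℤ.* + (suc n * ((suc n + suc n) P′ (K + K)))
    ≡ + ((n + n) C n) ℤ.* + (2 * (2 * n + 1) * ((suc n P′ a) * (suc n P′ b)))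
binomial-rational {n} N K a b N+K≡L a+b≡2K with a ℕ.≤? suc n
... | no a≰L rewrite m<n⇒+m-+n≡-[1+n∸[1+m]] (ℕ.≰⇒> a≰L) =
  scaled-zero n (cong (_* (suc n P′ b)) (P′-vanishes (ℕ.≰⇒> a≰L)))
... | yes a≤L rewrite +m-+n≡+[m∸n] a≤L with b ℕ.≤? suc n
...   | no b≰L = trans (trans (cong (λ c → + c ℤ.* Q) C≡0) (ℤ.*-zeroˡ Q))
                       (scaled-zero n (trans (cong ((suc n P′ a) *_) (P′-vanishes (ℕ.≰⇒> b≰L))) (ℕ.*-zeroʳ (suc n P′ a))))
  where
  Q = + (suc n * ((suc n + suc n) P′ (K + K)))
  C≡0 : (N + N) C (suc n ∸ a) ≡ 0
  C≡0 = k>n⇒nCk≡0 (N+N<i N K (suc n ∸ a) a b N+K≡L (ℕ.m∸n+n≡m a≤L) (ℕ.≰⇒> b≰L) a+b≡2K)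
...   | yes b≤L = begin
  + ((N + N) C i) ℤ.* + (L * ((L + L) P′ (K + K)))
    ≡⟨ ℤ.pos-* ((N + N) C i) _ ⟨
  + (((N + N) C i) * (L * ((L + L) P′ (K + K))))
    ≡⟨ cong +_ (cong₂ (λ m k → (m C i) * (L * ((L + L) P′ k))) (sym i+j≡2N) (sym a+b≡2K)) ⟩
  + (((i + j) C i) * (L * ((L + L) P′ (a + b))))
    ≡⟨ cong +_ (C*P′-ratio i j a b i+a≡L j+b≡L) ⟩
  + (((n + n) C n) * (2 * (2 * n + 1) * ((L P′ a) * (L P′ b))))
    ≡⟨ ℤ.pos-* ((n + n) C n) _ ⟩
  + ((n + n) C n) ℤ.* + (2 * (2 * n + 1) * ((L P′ a) * (L P′ b))) ∎
  where
  open ≡-Reasoning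
  L = suc n
  i = L ∸ a
  j = L ∸ b
  i+a≡L = ℕ.m∸n+n≡m a≤L
  j+b≡L = ℕ.m∸n+n≡m b≤L
  i+j≡2N = i+j≡N+N N K i j a b N+K≡L i+a≡L j+b≡L a+b≡2K

+∣K-s∣≡K-s : ∀ {K} s → ℤ.∣ s ∣ ≤ K → + ℤ.∣ + K ℤ.- s ∣ ≡ + K ℤ.- s
+∣K-s∣≡K-s (+ t)    t≤K rewrite +m-+n≡+[m∸n] t≤K = refl
+∣K-s∣≡K-s -[1+ t ] _   = refl

+∣K+s∣≡K+s : ∀ {K} s → ℤ.∣ s ∣ ≤ K → + ℤ.∣ + K ℤ.+ s ∣ ≡ + K ℤ.+ s
+∣K+s∣≡K+s (+ t)    _     = refl
+∣K+s∣≡K+s -[1+ t ] 1+t≤K rewrite ℤ.⊖-≥ 1+t≤K = refl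

centred-rational : ∀ {n N K} s → N + K ≡ suc n → ℤ.∣ s ∣ ≤ K →
  centred N s ℤ.* eval (denominator K) n ≡ + ((2 * n) C n) ℤ.* eval (numerator K s) n
centred-rational {n} {N} {K} s N+K≡L ∣s∣≤K = begin
  binomial (2 * N) (+ N ℤ.+ s) ℤ.* eval (denominator K) n
    ≡⟨ cong₂ ℤ._*_ (cong₂ binomial (double N) index) (eval-denominator K n) ⟩
  binomial (N + N) (+ suc n ℤ.- + a) ℤ.* + (suc n * ((suc n + suc n) P′ (K + K)))
    ≡⟨ binomial-rational N K a b N+K≡L a+b≡2K ⟩
  + ((n + n) C n) ℤ.* + (2 * (2 * n + 1) * ((suc n P′ a) * (suc n P′ b)))
    ≡⟨ cong₂ ℤ._*_ (cong (λ m → + (m C n)) (double n)) (eval-numerator K s n) ⟨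
  + ((2 * n) C n) ℤ.* eval (numerator K s) n ∎
  where
  open ≡-Reasoning
  a = ℤ.∣ + K ℤ.- s ∣
  b = ℤ.∣ + K ℤ.+ s ∣
  double : ∀ m → 2 * m ≡ m + m
  double m = cong (_+_ m) (ℕ.+-identityʳ m)
  1+n≡N+K : + suc n ≡ + N ℤ.+ + K
  1+n≡N+K = trans (cong +_ (sym N+K≡L)) (ℤ.pos-+ N K)
  index : + N ℤ.+ s ≡ + suc n ℤ.- + a
  index = begin
    + N ℤ.+ s                        ≡⟨ cancel (+ N) (+ K) s ⟩
    + N ℤ.+ + K ℤ.- (+ K ℤ.- s)      ≡⟨ cong₂ ℤ._-_ 1+n≡N+K (+∣K-s∣≡K-s s ∣s∣≤K) ⟨
    + suc n ℤ.- + a                  ∎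
    where
    cancel : ∀ n k s → n ℤ.+ s ≡ n ℤ.+ k ℤ.- (k ℤ.- s)
    cancel = solve-∀
  a+b≡2K : a + b ≡ K + K
  a+b≡2K = ℤ.+-injective (begin
    + (a + b)                        ≡⟨ ℤ.pos-+ a b ⟩
    + a ℤ.+ + b                      ≡⟨ cong₂ ℤ._+_ (+∣K-s∣≡K-s s ∣s∣≤K) (+∣K+s∣≡K+s s ∣s∣≤K) ⟩
    (+ K ℤ.- s) ℤ.+ (+ K ℤ.+ s)      ≡⟨ cancel (+ K) s ⟩
    + K ℤ.+ + K                      ≡⟨ ℤ.pos-+ K K ⟨
    + (K + K)                        ∎)
    where
    cancel : ∀ k s → (k ℤ.- s) ℤ.+ (k ℤ.+ s) ≡ k ℤ.+ k
    cancel = solve-∀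

numeratorSum : ℕ → List (ℤ × ℤ) → List ℤ
numeratorSum K []             = []
numeratorSum K ((c , s) ∷ ts) = scale c (numerator K s) ⊕ numeratorSum K ts

translates-rational : ∀ {n N K} ts → N + K ≡ suc n → ShiftsBounded K ts →
  translates ts (centred N) 0ℤ ℤ.* eval (denominator K) n ≡ + ((2 * n) C n) ℤ.* eval (numeratorSum K ts) n
translates-rational {n} {N} {K} [] _ [] =
  trans (ℤ.*-zeroˡ (eval (denominator K) n)) (sym (ℤ.*-zeroʳ (+ ((2 * n) C n))))
translates-rational {n} {N} {K} ((c , s) ∷ ts) N+K≡L (∣s∣≤K ∷ bs) = begin
  (c ℤ.* centred N (0ℤ ℤ.+ s) ℤ.+ translates ts (centred N) 0ℤ) ℤ.* D
    ≡⟨ cong (λ e → (c ℤ.* centred N e ℤ.+ translates ts (centred N) 0ℤ) ℤ.* D) (ℤ.+-identityˡ s) ⟩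
  (c ℤ.* centred N s ℤ.+ translates ts (centred N) 0ℤ) ℤ.* D
    ≡⟨ distrib c (centred N s) (translates ts (centred N) 0ℤ) D ⟩
  c ℤ.* (centred N s ℤ.* D) ℤ.+ translates ts (centred N) 0ℤ ℤ.* D
    ≡⟨ cong₂ (λ x y → c ℤ.* x ℤ.+ y) (centred-rational s N+K≡L ∣s∣≤K) (translates-rational ts N+K≡L bs) ⟩
  c ℤ.* (Cn ℤ.* eval (numerator K s) n) ℤ.+ Cn ℤ.* eval (numeratorSum K ts) n
    ≡⟨ factor c Cn (eval (numerator K s) n) (eval (numeratorSum K ts) n) ⟩
  Cn ℤ.* (c ℤ.* eval (numerator K s) n ℤ.+ eval (numeratorSum K ts) n)
    ≡⟨ cong (Cn ℤ.*_) (trans (eval-⊕ (scale c (numerator K s)) (numeratorSum K ts) n)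
                            (cong (ℤ._+ eval (numeratorSum K ts) n) (eval-scale c (numerator K s) n))) ⟨
  Cn ℤ.* eval (numeratorSum K ((c , s) ∷ ts)) n ∎
  where
  open ≡-Reasoning
  D = eval (denominator K) n
  Cn = + ((2 * n) C n)
  distrib : ∀ c x t d → (c ℤ.* x ℤ.+ t) ℤ.* d ≡ c ℤ.* (x ℤ.* d) ℤ.+ t ℤ.* d
  distrib = solve-∀
  factor : ∀ c k p r → c ℤ.* (k ℤ.* p) ℤ.+ k ℤ.* r ≡ k ℤ.* (c ℤ.* p ℤ.+ r)
  factor = solve-∀

denominator-nonzero : ∀ {K n} → K ≤ suc n → eval (scale (+ 2) (denominator K)) n ≢ 0ℤ
denominator-nonzero {K} {n} K≤L eval≡0 = P′-nonzero (ℕ.+-mono-≤ K≤L K≤L) P′≡0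
  where
  m = suc n * ((suc n + suc n) P′ (K + K))
  2m≡0 : 2 * m ≡ 0
  2m≡0 = ℤ.+-injective (begin
    + (2 * m)                                  ≡⟨ ℤ.pos-* 2 m ⟩
    + 2 ℤ.* + m                                ≡⟨ cong (+ 2 ℤ.*_) (eval-denominator K n) ⟨
    + 2 ℤ.* eval (denominator K) n             ≡⟨ eval-scale (+ 2) (denominator K) n ⟨
    eval (scale (+ 2) (denominator K)) n       ≡⟨ eval≡0 ⟩
    0ℤ                                         ∎)
    where open ≡-Reasoning
  P′≡0 : (suc n + suc n) P′ (K + K) ≡ 0
  P′≡0 with ℕ.m*n≡0⇒m≡0∨n≡0 2 2m≡0
  ... | inj₂ m≡0 with ℕ.m*n≡0⇒m≡0∨n≡0 (suc n) m≡0
  ...   | inj₂ P′≡0 = P′≡0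

toℚᵘ-ℤtoℚ : ∀ z → toℚᵘ (ℤtoℚ z) ℚᵘ.≃ mkℚᵘ z 0
toℚᵘ-ℤtoℚ z = ℚ.toℚᵘ-fromℚᵘ (mkℚᵘ z 0)

ℤtoℚ-+ : ∀ a b → ℤtoℚ (a ℤ.+ b) ≡ ℤtoℚ a ℚ.+ ℤtoℚ b
ℤtoℚ-+ a b = ℚ.toℚᵘ-injective (begin
  toℚᵘ (ℤtoℚ (a ℤ.+ b))              ≈⟨ toℚᵘ-ℤtoℚ (a ℤ.+ b) ⟩
  mkℚᵘ (a ℤ.+ b) 0                   ≡⟨ cong (λ x → mkℚᵘ x 0) (unit a b) ⟩
  mkℚᵘ a 0 ℚᵘ.+ mkℚᵘ b 0             ≈⟨ ℚᵘ.+-cong (toℚᵘ-ℤtoℚ a) (toℚᵘ-ℤtoℚ b) ⟨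
  toℚᵘ (ℤtoℚ a) ℚᵘ.+ toℚᵘ (ℤtoℚ b)   ≈⟨ ℚ.toℚᵘ-homo-+ (ℤtoℚ a) (ℤtoℚ b) ⟨
  toℚᵘ (ℤtoℚ a ℚ.+ ℤtoℚ b)           ∎)
  where
  open ℚᵘ.≃-Reasoning
  unit : ∀ a b → a ℤ.+ b ≡ a ℤ.* + 1 ℤ.+ b ℤ.* + 1
  unit = solve-∀

ℤtoℚ-* : ∀ a b → ℤtoℚ (a ℤ.* b) ≡ ℤtoℚ a ℚ.* ℤtoℚ b
ℤtoℚ-* a b = ℚ.toℚᵘ-injective (begin
  toℚᵘ (ℤtoℚ (a ℤ.* b))              ≈⟨ toℚᵘ-ℤtoℚ (a ℤ.* b) ⟩
  mkℚᵘ a 0 ℚᵘ.* mkℚᵘ b 0             ≈⟨ ℚᵘ.*-cong (toℚᵘ-ℤtoℚ a) (toℚᵘ-ℤtoℚ b) ⟨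
  toℚᵘ (ℤtoℚ a) ℚᵘ.* toℚᵘ (ℤtoℚ b)   ≈⟨ ℚ.toℚᵘ-homo-* (ℤtoℚ a) (ℤtoℚ b) ⟨
  toℚᵘ (ℤtoℚ a ℚ.* ℤtoℚ b)           ∎)
  where open ℚᵘ.≃-Reasoning

ℤtoℚ≡0⇒≡0 : ∀ {z} → ℤtoℚ z ≡ 0ℚ → z ≡ 0ℤ
ℤtoℚ≡0⇒≡0 {z} eq with ℚᵘ.≃-trans (ℚᵘ.≃-sym (toℚᵘ-ℤtoℚ z)) (ℚ.toℚᵘ-cong eq)
... | *≡* z*1≡0 = trans (sym (ℤ.*-identityʳ z)) z*1≡0

evalPoly-map-ℤtoℚ : ∀ p n → evalPoly (map ℤtoℚ p) n ≡ ℤtoℚ (eval p n)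
evalPoly-map-ℤtoℚ []       n = refl
evalPoly-map-ℤtoℚ (c ∷ cs) n = begin
  ℤtoℚ c ℚ.+ ℤtoℚ (+ n) ℚ.* evalPoly (map ℤtoℚ cs) n
    ≡⟨ cong (λ x → ℤtoℚ c ℚ.+ ℤtoℚ (+ n) ℚ.* x) (evalPoly-map-ℤtoℚ cs n) ⟩
  ℤtoℚ c ℚ.+ ℤtoℚ (+ n) ℚ.* ℤtoℚ (eval cs n)         ≡⟨ cong (ℚ._+_ (ℤtoℚ c)) (ℤtoℚ-* (+ n) (eval cs n)) ⟨
  ℤtoℚ c ℚ.+ ℤtoℚ (+ n ℤ.* eval cs n)                ≡⟨ ℤtoℚ-+ c (+ n ℤ.* eval cs n) ⟨
  ℤtoℚ (c ℤ.+ + n ℤ.* eval cs n)                     ∎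
  where open ≡-Reasoning

ℤtoℚ-cross-multiplication : ∀ p q n {x c} → x ℤ.* eval q n ≡ eval p n ℤ.* c →
  ℤtoℚ x ℚ.* evalPoly (map ℤtoℚ q) n ≡ evalPoly (map ℤtoℚ p) n ℚ.* ℤtoℚ c
ℤtoℚ-cross-multiplication p q n {x} {c} eq = begin
  ℤtoℚ x ℚ.* evalPoly (map ℤtoℚ q) n        ≡⟨ cong (ℚ._*_ (ℤtoℚ x)) (evalPoly-map-ℤtoℚ q n) ⟩
  ℤtoℚ x ℚ.* ℤtoℚ (eval q n)                ≡⟨ ℤtoℚ-* x (eval q n) ⟨
  ℤtoℚ (x ℤ.* eval q n)                     ≡⟨ cong ℤtoℚ eq ⟩
  ℤtoℚ (eval p n ℤ.* c)                     ≡⟨ ℤtoℚ-* (eval p n) c ⟩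
  ℤtoℚ (eval p n) ℚ.* ℤtoℚ c                ≡⟨ cong (ℚ._* ℤtoℚ c) (evalPoly-map-ℤtoℚ p n) ⟨
  evalPoly (map ℤtoℚ p) n ℚ.* ℤtoℚ c        ∎
  where open ≡-Reasoning

evalPoly-map-ℤtoℚ≢0 : ∀ p n → eval p n ≢ 0ℤ → evalPoly (map ℤtoℚ p) n ≢ 0ℚ
evalPoly-map-ℤtoℚ≢0 p n eval≢0 eq = eval≢0 (ℤtoℚ≡0⇒≡0 (trans (sym (evalPoly-map-ℤtoℚ p n)) eq))

ψ2-rational : ∀ μ₀ → All (1 ≤_) μ₀ → ∀ {n} → size μ₀ ≤ n →
  ψ2 n (padOnes μ₀ n) ℤ.* eval (scale (+ 2) (denominator (suc (size μ₀)))) n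
    ≡ eval (numeratorSum (suc (size μ₀)) (shiftsOf μ₀)) n ℤ.* + ((2 * n) C n)
ψ2-rational μ₀ pos {n} k≤n = begin
  ψ ℤ.* eval (scale (+ 2) (denominator K)) n
    ≡⟨ cong (ψ ℤ.*_) (eval-scale (+ 2) (denominator K) n) ⟩
  ψ ℤ.* (+ 2 ℤ.* D)
    ≡⟨ double ψ D ⟩
  (ψ ℤ.+ ψ) ℤ.* D
    ≡⟨ cong (ℤ._* D) (ψ2+ψ2≡autocorrelation n μ (padOnes-positive μ₀ n pos) (size-padOnes μ₀ k≤n)) ⟩
  autocorrelation μ 0ℤ ℤ.* D
    ≡⟨ cong (ℤ._* D) (autocorrelation-padded μ₀ N 0ℤ) ⟩
  translates (shiftsOf μ₀) (centred N) 0ℤ ℤ.* D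
    ≡⟨ translates-rational (shiftsOf μ₀) N+K≡1+n (shiftsOf-bounded μ₀) ⟩
  + ((2 * n) C n) ℤ.* eval (numeratorSum K (shiftsOf μ₀)) n
    ≡⟨ ℤ.*-comm (+ ((2 * n) C n)) _ ⟩
  eval (numeratorSum K (shiftsOf μ₀)) n ℤ.* + ((2 * n) C n) ∎
  where
  open ≡-Reasoning
  K = suc (size μ₀)
  N = n ∸ size μ₀
  μ = padOnes μ₀ n
  ψ = ψ2 n μ
  D = eval (denominator K) n
  N+K≡1+n : N + K ≡ suc n
  N+K≡1+n = trans (ℕ.+-suc N (size μ₀)) (cong suc (ℕ.m∸n+n≡m k≤n))
  double : ∀ x d → x ℤ.* (+ 2 ℤ.* d) ≡ (x ℤ.+ x) ℤ.* d
  double = solve-∀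

mainTheorem2 : (μ₀ : List ℕ) → IsPartition μ₀ → All (λ a → 2 ≤ a) μ₀ →
    Σ (List ℚ) λ P → Σ (List ℚ) λ Q →
      ((n : ℕ) → size μ₀ ≤ n →
        (evalPoly Q n ≢ 0ℚ)
        × (ℤtoℚ (ψ2 n (padOnes μ₀ n)) Data.Rational.* evalPoly Q n
             ≡ evalPoly P n Data.Rational.* ℕtoℚ ((2 * n) C n)))
mainTheorem2 μ₀ (_ , pos) _ = map ℤtoℚ p , map ℤtoℚ q , λ n k≤n →
  evalPoly-map-ℤtoℚ≢0 q n (denominator-nonzero (s≤s k≤n)) ,
  ℤtoℚ-cross-multiplication p q n {x = ψ2 n (padOnes μ₀ n)} (ψ2-rational μ₀ pos k≤n)
  where
  p = numeratorSum (suc (size μ₀)) (shiftsOf μ₀)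
  q = scale (+ 2) (denominator (suc (size μ₀)))
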